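{- Let $I\subseteq\omega^{<\omega}$ be a primitively recursively branching tree, i.e. there is a primitive recursive function $b$ such that every string in $I$ of length $n$ has all its entries bounded by $b(n)$ (so the set of strings of length $n$ in $I$ can be primitively recursively listed). Let $[I]$ denote the set of infinite paths $x\in\omega^\omega$ all of whose initial segments lie in $I$, and let $f$ be a Turing functional which, given oracle $x\in[I]$, computes a total function $n\mapsto f^x(n)$. Then the following are equivalent: (1) $f$ possesses a primitive recursive time-function, i.e. there is a primitive recursive $t$ such that for every $x\in[I]$ and every input $n$, the computation of $f^x(n)$ halts within $t(n)$ steps (in particular it queries the oracle only below $t(n)$ and its output has size at most $t(n)$); (2) $f$ is a primitive recursive functional, i.e. $f^x$ is obtained, uniformly in $x\in[I]$, by a primitive recursive scheme (built from the basic functions by composition and primitive recursion) augmented by the oracle function $x$ as an extra basic function. Moreover, if $f$ possesses a primitive recursive time-function $t$ (which may be taken nondecreasing), then there is a primitively recursively branching tree $I'$ whose nodes of length $n$ are in a primitive recursive, extension-preserving one-to-one correspondence with the nodes of $I$ of length $t(n)$, such that $f$ induces a primitive recursive function on $I'$ without lookahead: for every $x\in[I]$ the value $f^x(n)$ is computed primitively recursively from the node of $I'$ of length $n$ corresponding to $x\upharpoonright t(n)$ alone.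
   Context: Strings of natural numbers are identified with their natural number codes under a standard primitive recursive coding; "primitive recursive" for functions on strings refers to this coding. -}

module Defs where

open import Data.Nat using (ℕ; zero; suc; _+_; _*_; _∸_; _^_; _≤_; _<_; _≡ᵇ_)
open import Data.Bool using (Bool; true; false; if_then_else_)
open import Data.Fin using (Fin)
open import Data.Vec using (Vec; []; _∷_)
import Data.Vec as Vec
open import Data.List using (List; []; _∷_; _++_; length; upTo; map)
open import Data.List.Relation.Unary.All using (All)
open import Data.Maybe using (Maybe; just; nothing)
open import Data.Product using (Σ; ∃; ∃-syntax; _×_; _,_)
open import Relation.Binary.PropositionalEquality using (_≡_)
open import Function.Bundles using (_⇔_)

-- Prim false k : ordinary primitive recursive schemes of arity k
-- Prim true  k : schemes that may additionally use the oracle x (unary)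

data Prim : Bool → ℕ → Set where
  Z    : ∀ {o k} → Prim o k
  S    : ∀ {o} → Prim o 1
  P    : ∀ {o k} → Fin k → Prim o k
  comp : ∀ {o m k} → Prim o m → Vec (Prim o k) m → Prim o k
  rec  : ∀ {o k} → Prim o k → Prim o (suc (suc k)) → Prim o (suc k)
  orc  : Prim true 1

mutual
  eval : ∀ {o k} → (ℕ → ℕ) → Prim o k → Vec ℕ k → ℕ
  eval x Z v = 0
  eval x S (n ∷ []) = suc n
  eval x (P i) v = Vec.lookup v i
  eval x (comp g hs) v = eval x g (evalVec x hs v)
  eval x (rec g h) (zero ∷ v) = eval x g v
  eval x (rec g h) (suc n ∷ v) = eval x h (n ∷ eval x (rec g h) (n ∷ v) ∷ v)
  eval x orc (n ∷ []) = x n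

  evalVec : ∀ {o m k} → (ℕ → ℕ) → Vec (Prim o k) m → Vec ℕ k → Vec ℕ m
  evalVec x [] v = []
  evalVec x (h ∷ hs) v = eval x h v ∷ evalVec x hs v

-- evaluation of an oracle-free term (the oracle argument is never used)
evalPR : ∀ {k} → Prim false k → Vec ℕ k → ℕ
evalPR = eval (λ _ → 0)

IsPR1 : (ℕ → ℕ) → Set
IsPR1 f = Σ (Prim false 1) λ p → ∀ n → evalPR p (n ∷ []) ≡ f n

IsPR2 : (ℕ → ℕ → ℕ) → Set
IsPR2 f = Σ (Prim false 2) λ p → ∀ m n → evalPR p (m ∷ n ∷ []) ≡ f m n

-- Standard primitive recursive coding of strings:
-- code [] = 0 ,  code (a ∷ s) = 2^a * (2 * code s + 1)   (a bijection List ℕ ≅ ℕ)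

code : List ℕ → ℕ
code [] = 0
code (a ∷ s) = 2 ^ a * (2 * code s + 1)

IsPRStr2 : (ℕ → List ℕ → List ℕ) → Set
IsPRStr2 Φ = Σ (ℕ → ℕ → ℕ) λ h → IsPR2 h × (∀ n σ → h n (code σ) ≡ code (Φ n σ))

_⊑_ : List ℕ → List ℕ → Set
σ ⊑ τ = ∃[ w ] σ ++ w ≡ τ

_↾_ : (ℕ → ℕ) → ℕ → List ℕ
x ↾ k = map x (upTo k)

record PRBTree : Set where
  field
    χ      : ℕ → ℕ
    χ-pr   : IsPR1 χ
    b      : ℕ → ℕ
    b-pr   : IsPR1 b
  Mem : List ℕ → Set
  Mem s = χ (code s) ≡ 1
  field
    prefix-closed : ∀ s a → Mem (s ++ a ∷ []) → Mem s
    bounded       : ∀ s → Mem s → All (λ a → a ≤ b (length s)) s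

open PRBTree public

Path : PRBTree → (ℕ → ℕ) → Set
Path I x = ∀ k → Mem I (x ↾ k)

-- Turing functionals: oracle register machines.
-- Registers indexed by ℕ, input in register 0, output in register 0.

data Instr : Set where
  inc   : ℕ → Instr
  decjz : ℕ → ℕ → Instr
  query : ℕ → ℕ → Instr

Program : Set
Program = List Instr

fetch : Program → ℕ → Maybe Instr
fetch [] _ = nothing
fetch (i ∷ p) zero = just i
fetch (i ∷ p) (suc k) = fetch p k

record Config : Set where
  constructor ⟨_,_⟩
  field
    pc  : ℕ
    reg : ℕ → ℕ
open Config public

update : (ℕ → ℕ) → ℕ → ℕ → (ℕ → ℕ)
update ρ r v k = if k ≡ᵇ r then v else ρ k

exec : (ℕ → ℕ) → Instr → Config → Config
exec x (inc r) ⟨ p , ρ ⟩ = ⟨ suc p , update ρ r (suc (ρ r)) ⟩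
exec x (decjz r j) ⟨ p , ρ ⟩ with ρ r
... | zero  = ⟨ j , ρ ⟩
... | suc v = ⟨ suc p , update ρ r v ⟩
exec x (query r s) ⟨ p , ρ ⟩ = ⟨ suc p , update ρ r (x (ρ s)) ⟩

step : (ℕ → ℕ) → Program → Config → Config
step x M c with fetch M (pc c)
... | nothing = c
... | just i  = exec x i c

run : (ℕ → ℕ) → Program → ℕ → Config → Config
run x M zero c = c
run x M (suc s) c = step x M (run x M s c)

init : ℕ → Config
init n = ⟨ 0 , update (λ _ → 0) 0 n ⟩

Halted : Program → Config → Set
Halted M c = fetch M (pc c) ≡ nothing

output : Config → ℕ
output c = reg c 0

QueryBelow : Program → Config → ℕ → Set
QueryBelow M c bound = ∀ r s → fetch M (pc c) ≡ just (query r s) → reg c s < bound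

ComputedBy : PRBTree → ((ℕ → ℕ) → ℕ → ℕ) → Program → Set
ComputedBy I f M = ∀ x → Path I x → ∀ n →
  ∃[ s ] (Halted M (run x M s (init n)) × output (run x M s (init n)) ≡ f x n)

IsTuringFunctional : PRBTree → ((ℕ → ℕ) → ℕ → ℕ) → Set
IsTuringFunctional I f = ∃[ M ] ComputedBy I f M

TimeFn : PRBTree → ((ℕ → ℕ) → ℕ → ℕ) → Program → (ℕ → ℕ) → Set
TimeFn I f M t = ∀ x → Path I x → ∀ n →
  ∃[ s ] (s ≤ t n
         × Halted M (run x M s (init n))
         × output (run x M s (init n)) ≡ f x n
         × output (run x M s (init n)) ≤ t n
         × (∀ i → i < s → QueryBelow M (run x M i (init n)) (t n)))

HasPRTimeFn : PRBTree → ((ℕ → ℕ) → ℕ → ℕ) → Set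
HasPRTimeFn I f = ∃[ M ] ∃[ t ] (IsPR1 t × TimeFn I f M t)

IsPRFunctional : PRBTree → ((ℕ → ℕ) → ℕ → ℕ) → Set
IsPRFunctional I f = Σ (Prim true 1) λ p →
  ∀ x → Path I x → ∀ n → eval x p (n ∷ []) ≡ f x n

Nondecreasing : (ℕ → ℕ) → Set
Nondecreasing t = ∀ m n → m ≤ n → t m ≤ t n

-- The "no lookahead" conclusion (levels shifted by one: the I'-node of
-- length n+1 corresponds to the I-node of length t n).
NoLookahead : PRBTree → ((ℕ → ℕ) → ℕ → ℕ) → (ℕ → ℕ) → Set
NoLookahead I f t =
  Σ PRBTree λ I' → Σ (ℕ → List ℕ → List ℕ) λ Φ →
    IsPRStr2 Φ
    × (∀ n σ → Mem I σ → length σ ≡ t n → Mem I' (Φ n σ) × length (Φ n σ) ≡ suc n)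
    × (∀ n σ τ → Mem I σ → length σ ≡ t n → Mem I τ → length τ ≡ t n →
         Φ n σ ≡ Φ n τ → σ ≡ τ)
    × (∀ n ρ → Mem I' ρ → length ρ ≡ suc n →
         ∃[ σ ] (Mem I σ × length σ ≡ t n × Φ n σ ≡ ρ))
    × (∀ m n σ τ → m ≤ n → Mem I σ → length σ ≡ t m → Mem I τ → length τ ≡ t n →
         (σ ⊑ τ ⇔ Φ m σ ⊑ Φ n τ))
    × (∃[ g ] (IsPR1 g × (∀ x → Path I x → ∀ n → f x n ≡ g (code (Φ n (x ↾ t n))))))

module Submission where

open import Defs
open import Data.Nat using (ℕ; _≤_)
open import Data.Bool using (Bool)
open import Data.Vec using (Vec; []; _∷_; head; lookup)
open import Data.Product using (_×_; _,_)
open import Function.Bundles using (_⇔_; mk⇔)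

module NatFacts where

  open import Data.Nat
  open import Data.Nat.Properties
  open import Relation.Binary.PropositionalEquality

  sub-suc : ∀ v n → n < v → suc (v ∸ suc n) ≡ v ∸ n
  sub-suc v n lt = sym (+-∸-assoc 1 lt)

-- A semantic function
-- F : Fn k (an oracle-dependent k-ary function) is represented when some term of
-- Prim o k evaluates to it; representations are closed under the schemes of
-- Prim, so in the rest of the file primitive recursiveness is established by
-- building Rep values compositionally instead of writing terms by hand.
module PrimRep where

  open import Defs
  open import Data.Nat
  open import Data.Nat.Properties
  open import Data.Bool using (Bool; true; false)
  open import Data.Fin using (Fin; zero; suc)
  open import Data.Vec using (Vec; []; _∷_; lookup; head)
  open import Relation.Binary.PropositionalEquality
  open import Data.Product using (_,_; ∃-syntax)

  Fn : ℕ → Set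
  Fn k = (ℕ → ℕ) → Vec ℕ k → ℕ

  record Rep (o : Bool) {k : ℕ} (F : Fn k) : Set where
    constructor rep
    field
      tm : Prim o k
      ok : ∀ x v → eval x tm v ≡ F x v
  open Rep public

  ext : ∀ {o k} {F G : Fn k} → Rep o F → (∀ x v → F x v ≡ G x v) → Rep o G
  ext (rep t p) e = rep t (λ x v → trans (p x v) (e x v))

  rZ : ∀ {o k} → Rep o {k} (λ _ _ → 0)
  rZ = rep Z (λ _ _ → refl)

  rS : ∀ {o} → Rep o {1} (λ _ v → suc (head v))
  rS = rep S (λ { _ (n ∷ []) → refl })

  rP : ∀ {o k} (i : Fin k) → Rep o (λ _ v → lookup v i)
  rP i = rep (P i) (λ _ _ → refl)

  rO : Rep true {1} (λ x v → x (head v))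
  rO = rep orc (λ { _ (n ∷ []) → refl })

  infixr 5 _∷ʳ_
  data Reps (o : Bool) {k : ℕ} : ∀ {m} → Vec (Fn k) m → Set where
    []ʳ : Reps o []
    _∷ʳ_ : ∀ {m} {F : Fn k} {Fs : Vec (Fn k) m} → Rep o F → Reps o Fs → Reps o (F ∷ Fs)

  app : ∀ {k m} → Vec (Fn k) m → (ℕ → ℕ) → Vec ℕ k → Vec ℕ m
  app [] x v = []
  app (F ∷ Fs) x v = F x v ∷ app Fs x v

  tms : ∀ {o k m} {Fs : Vec (Fn k) m} → Reps o Fs → Vec (Prim o k) m
  tms []ʳ = []
  tms (r ∷ʳ rs) = tm r ∷ tms rs

  tmsOk : ∀ {o k m} {Fs : Vec (Fn k) m} (rs : Reps o Fs) x v → evalVec x (tms rs) v ≡ app Fs x v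
  tmsOk []ʳ x v = refl
  tmsOk (r ∷ʳ rs) x v = cong₂ _∷_ (ok r x v) (tmsOk rs x v)

  rC : ∀ {o k m} {G : Fn m} {Fs : Vec (Fn k) m} → Rep o G → Reps o Fs →
       Rep o (λ x v → G x (app Fs x v))
  rC {G = G} (rep g pg) rs = rep (comp g (tms rs)) (λ x v → trans (pg x _) (cong (G x) (tmsOk rs x v)))

  Rec : ∀ {k} → Fn k → Fn (suc (suc k)) → Fn (suc k)
  Rec G H x (zero ∷ v) = G x v
  Rec G H x (suc n ∷ v) = H x (n ∷ Rec G H x (n ∷ v) ∷ v)

  rR : ∀ {o k} {G : Fn k} {H : Fn (suc (suc k))} → Rep o G → Rep o H → Rep o (Rec G H)
  rR {o} {k} {G} {H} (rep g pg) (rep h ph) = rep (rec g h) okR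
    where
    okR : ∀ x v → eval x (rec g h) v ≡ Rec G H x v
    okR x (zero ∷ v) = pg x v
    okR x (suc n ∷ v) = trans (ph x _) (cong (λ r → H x (n ∷ r ∷ v)) (okR x (n ∷ v)))

  mutual
    -- Oracle-free terms embed into oracle terms without changing their value;
    -- this lets a primitive recursive t (given by IsPR1) be used inside functionals.
    lift : ∀ {o k} → Prim false k → Prim o k
    lift Z = Z
    lift S = S
    lift (P i) = P i
    lift (comp g hs) = comp (lift g) (liftV hs)
    lift (rec g h) = rec (lift g) (lift h)

    liftV : ∀ {o m k} → Vec (Prim false k) m → Vec (Prim o k) m
    liftV [] = []
    liftV (h ∷ hs) = lift h ∷ liftV hs

  mutual
    liftOk : ∀ {o k} (p : Prim false k) x y v → eval {o} x (lift p) v ≡ eval y p v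
    liftOk Z x y v = refl
    liftOk S x y (n ∷ []) = refl
    liftOk (P i) x y v = refl
    liftOk (comp g hs) x y v = trans (cong (eval x (lift g)) (liftVOk hs x y v)) (liftOk g x y _)
    liftOk (rec g h) x y (zero ∷ v) = liftOk g x y v
    liftOk (rec g h) x y (suc n ∷ v) =
      trans (cong (λ r → eval x (lift h) (n ∷ r ∷ v)) (liftOk (rec g h) x y (n ∷ v))) (liftOk h x y _)

    liftVOk : ∀ {o m k} (hs : Vec (Prim false k) m) x y v → evalVec {o} x (liftV hs) v ≡ evalVec y hs v
    liftVOk [] x y v = refl
    liftVOk (h ∷ hs) x y v = cong₂ _∷_ (liftOk h x y v) (liftVOk hs x y v)

  rPR1 : ∀ {o} {t : ℕ → ℕ} → IsPR1 t → Rep o {1} (λ _ v → t (head v))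
  rPR1 (p , e) = rep (lift p) (λ { x (n ∷ []) → trans (liftOk p x (λ _ → 0) (n ∷ [])) (e n) })

  toPR1 : ∀ {t : ℕ → ℕ} → Rep false {1} (λ _ v → t (head v)) → IsPR1 t
  toPR1 (rep p e) = p , (λ n → e (λ _ → 0) (n ∷ []))

  toPR2 : ∀ {t : ℕ → ℕ → ℕ} → Rep false {2} (λ _ v → t (head v) (head (Data.Vec.tail v))) → IsPR2 t
  toPR2 (rep p e) = p , (λ m n → e (λ _ → 0) (m ∷ n ∷ []))

  rK : ∀ {o k} (c : ℕ) → Rep o {k} (λ _ _ → c)
  rK zero = rZ
  rK (suc c) = rC rS (rK c ∷ʳ []ʳ)

  pattern #0 = zero
  pattern #1 = suc zero
  pattern #2 = suc (suc zero)
  pattern #3 = suc (suc (suc zero))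

  addT : ∀ {o} → Prim o 2
  addT = rec (P #0) (comp S (P #1 ∷ []))

  addOk : ∀ {o} x a b → eval {o} x addT (a ∷ b ∷ []) ≡ a + b
  addOk x zero b = refl
  addOk x (suc a) b = cong suc (addOk x a b)

  mulT : ∀ {o} → Prim o 2
  mulT = rec Z (comp addT (P #1 ∷ P #2 ∷ []))

  mulOk : ∀ {o} x a b → eval {o} x mulT (a ∷ b ∷ []) ≡ a * b
  mulOk x zero b = refl
  mulOk {o} x (suc a) b = trans (addOk x (eval {o} x mulT (a ∷ b ∷ [])) b) (trans (cong (_+ b) (mulOk x a b)) (+-comm (a * b) b))

  predT : ∀ {o} → Prim o 1
  predT = rec Z (P #0)

  predOk : ∀ {o} x a → eval {o} x predT (a ∷ []) ≡ pred a
  predOk x zero = refl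
  predOk x (suc a) = refl

  subT : ∀ {o} → Prim o 2   -- (b , a) ↦ a ∸ b
  subT = rec (P #0) (comp predT (P #1 ∷ []))

  subOk : ∀ {o} x b a → eval {o} x subT (b ∷ a ∷ []) ≡ a ∸ b
  subOk x zero a = refl
  subOk {o} x (suc b) a = trans (predOk x (eval {o} x subT (b ∷ a ∷ []))) (trans (cong pred (subOk x b a)) (pred[m∸n]≡m∸[1+n] a b))

  monusT : ∀ {o} → Prim o 2
  monusT = comp subT (P #1 ∷ P #0 ∷ [])

  monusOk : ∀ {o} x a b → eval {o} x monusT (a ∷ b ∷ []) ≡ a ∸ b
  monusOk x a b = subOk x b a

  ifz : ℕ → ℕ → ℕ → ℕ
  ifz zero a b = a
  ifz (suc _) a b = b

  ifzT : ∀ {o} → Prim o 3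
  ifzT = rec (P #0) (P #3)

  ifzOk : ∀ {o} x c a b → eval {o} x ifzT (c ∷ a ∷ b ∷ []) ≡ ifz c a b
  ifzOk x zero a b = refl
  ifzOk x (suc c) a b = refl

  rAdd : ∀ {o} → Rep o {2} (λ _ v → head v + head (Data.Vec.tail v))
  rAdd = rep addT (λ { x (a ∷ b ∷ []) → addOk x a b })

  rMul : ∀ {o} → Rep o {2} (λ _ v → head v * head (Data.Vec.tail v))
  rMul = rep mulT (λ { x (a ∷ b ∷ []) → mulOk x a b })

  rMonus : ∀ {o} → Rep o {2} (λ _ v → head v ∸ head (Data.Vec.tail v))
  rMonus = rep monusT (λ { x (a ∷ b ∷ []) → monusOk x a b })

  rPred : ∀ {o} → Rep o {1} (λ _ v → pred (head v))
  rPred = rep predT (λ { x (a ∷ []) → predOk x a })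

  rIfz : ∀ {o} → Rep o {3} (λ _ v → ifz (head v) (head (Data.Vec.tail v)) (head (Data.Vec.tail (Data.Vec.tail v))))
  rIfz = rep ifzT (λ { x (c ∷ a ∷ b ∷ []) → ifzOk x c a b })

  infixl 6 _⊕_ _⊖_
  infixl 7 _⊗_
  infixr 9 _·_
  _⊕_ : ∀ {o k} {F G : Fn k} → Rep o F → Rep o G → Rep o (λ x v → F x v + G x v)
  r ⊕ s = rC rAdd (r ∷ʳ s ∷ʳ []ʳ)

  _⊗_ : ∀ {o k} {F G : Fn k} → Rep o F → Rep o G → Rep o (λ x v → F x v * G x v)
  r ⊗ s = rC rMul (r ∷ʳ s ∷ʳ []ʳ)

  _⊖_ : ∀ {o k} {F G : Fn k} → Rep o F → Rep o G → Rep o (λ x v → F x v ∸ G x v)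
  r ⊖ s = rC rMonus (r ∷ʳ s ∷ʳ []ʳ)

  rIf : ∀ {o k} {Cnd F G : Fn k} → Rep o Cnd → Rep o F → Rep o G → Rep o (λ x v → ifz (Cnd x v) (F x v) (G x v))
  rIf c r s = rC rIfz (c ∷ʳ r ∷ʳ s ∷ʳ []ʳ)

  _·_ : ∀ {o k} {G : Fn 1} {F : Fn k} → Rep o G → Rep o F → Rep o (λ x v → G x (F x v ∷ []))
  g · f = rC g (f ∷ʳ []ʳ)

-- We define head and tail of a code by bounded iteration (so that they are visibly
-- primitive recursive), prove they invert code, and deduce that code is a bijection.
module StringCode where

  open import Defs
  open PrimRep
  open import Data.Nat
  open import Data.Nat.Properties
  open import Data.Nat.Induction using (<-wellFounded)
  open import Induction.WellFounded using (Acc; acc)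
  open import Data.Vec using ([]; _∷_)
  open import Data.List using ([]; _∷_)
  open import Data.Product using (_,_; ∃-syntax)
  open import Data.Sum using (_⊎_; inj₁; inj₂)
  open import Relation.Binary.PropositionalEquality
  open import Data.Empty using (⊥-elim)

  par : ℕ → ℕ
  par zero = 0
  par (suc n) = ifz (par n) 1 0

  half : ℕ → ℕ
  half zero = 0
  half (suc n) = half n + par n

  db : ℕ → ℕ
  db zero = 0
  db (suc y) = suc (suc (db y))

  db≡ : ∀ y → db y ≡ 2 * y
  db≡ zero = refl
  db≡ (suc y) = trans (cong (λ z → suc (suc z)) (db≡ y)) (cong suc (sym (+-suc y (y + 0))))

  par-db : ∀ y → par (db y) ≡ 0
  par-sdb : ∀ y → par (suc (db y)) ≡ 1
  par-db zero = refl
  par-db (suc y) = cong (λ z → ifz z 1 0) (par-sdb y)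
  par-sdb y = cong (λ z → ifz z 1 0) (par-db y)

  half-sdb : ∀ y → half (suc (db y)) ≡ y
  half-db : ∀ y → half (db y) ≡ y
  half-db zero = refl
  half-db (suc y) = trans (cong₂ _+_ (half-sdb y) (par-sdb y)) (+-comm y 1)
  half-sdb y = trans (cong₂ _+_ (half-db y) (par-db y)) (+-identityʳ y)

  par01 : ∀ n → par n ≡ 0 ⊎ par n ≡ 1
  par01 zero = inj₁ refl
  par01 (suc n) with par n | par01 n
  ... | .0 | inj₁ refl = inj₂ refl
  ... | .1 | inj₂ refl = inj₁ refl

  par-half : ∀ n → n ≡ par n + db (half n)
  par-half zero = refl
  par-half (suc n) with par n | par01 n | par-half n
  ... | .0 | inj₁ refl | e = trans (cong suc e) (cong (λ z → suc (db z)) (sym (+-identityʳ (half n))))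
  ... | .1 | inj₂ refl | e = trans (cong suc e) (lem (half n))
    where
    lem : ∀ h → suc (suc (db h)) ≡ 0 + db (h + 1)
    lem zero = refl
    lem (suc h) = cong (λ z → suc (suc z)) (lem h)

  decomp : ∀ y → 0 < y → ∃[ a ] ∃[ m ] (y ≡ 2 ^ a * suc (db m))
  decomp y = go y (<-wellFounded y)
    where
    go : ∀ y → Acc _<_ y → 0 < y → ∃[ a ] ∃[ m ] (y ≡ 2 ^ a * suc (db m))
    go y (acc rs) y>0 with par y | par01 y | par-half y
    ... | .1 | inj₂ refl | e = 0 , half y , trans e (sym (+-identityʳ _))
    ... | .0 | inj₁ refl | e with half y | e
    ...   | zero | e' = ⊥-elim (<-irrefl (sym e') y>0)
    ...   | suc h | e' with go (suc h) (rs hlt) (s≤s z≤n)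
      where
      hlt : suc h < y
      hlt = subst (suc h <_) (sym e') (lemlt h)
        where
        lemlt : ∀ h → suc h < 0 + db (suc h)
        lemlt zero = s≤s (s≤s z≤n)
        lemlt (suc h) = s≤s (≤-trans (lemlt h) (n≤1+n _))
    ...     | a , m , e2 = suc a , m , trans e' (trans (cong db e2) (trans (db≡ _) (sym (*-assoc 2 (2 ^ a) _))))

  code-surj : ∀ y → ∃[ σ ] (code σ ≡ y)
  code-surj y = go y (<-wellFounded y)
    where
    go : ∀ y → Acc _<_ y → ∃[ σ ] (code σ ≡ y)
    go zero _ = [] , refl
    go (suc y) (acc rs) with decomp (suc y) (s≤s z≤n)
    ... | a , m , e with go m (rs mlt)
      where
      mlt : m < suc y
      mlt = subst (m <_) (sym e) (≤-trans (s≤s (lem m)) (m≤n*m (suc (db m)) (2 ^ a) {{ >-nonZero (m^n>0 2 a) }}))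
        where
        lem : ∀ m → m ≤ db m
        lem zero = z≤n
        lem (suc m) = s≤s (≤-trans (lem m) (n≤1+n _))
    ... | σ , eσ = (a ∷ σ) , trans (cong (λ z → 2 ^ a * (2 * z + 1)) eσ) (trans (cong (2 ^ a *_) (trans (+-comm (2 * m) 1) (cong suc (sym (db≡ m))))) (sym e))

  -- hstep halves even numbers and fixes odd ones; od k y iterates it k times and
  -- ex k y counts how many of these k steps halved, so after y steps od y y is the
  -- odd part of y and ex y y its 2-adic valuation.
  hstep : ℕ → ℕ
  hstep y = ifz (par y) (half y) y

  od : ℕ → ℕ → ℕ
  od zero y = y
  od (suc k) y = hstep (od k y)

  ex : ℕ → ℕ → ℕ
  ex zero y = 0
  ex (suc k) y = ex k y + ifz (par (od k y)) 1 0

  hd : ℕ → ℕ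
  hd y = ex y y

  tl : ℕ → ℕ
  tl y = half (pred (od y y))

  hstep-2 : ∀ z → hstep (2 * z) ≡ z
  hstep-2 z rewrite sym (db≡ z) | par-db z = half-db z

  hstep-odd : ∀ m → hstep (suc (db m)) ≡ suc (db m)
  hstep-odd m rewrite par-sdb m = refl

  od-ev : ∀ k j w → od k (2 ^ (k + j) * w) ≡ 2 ^ j * w
  ex-ev : ∀ k j w → ex k (2 ^ (k + j) * w) ≡ k
  od-ev zero j w = refl
  od-ev (suc k) j w = trans (cong (λ e → hstep (od k (2 ^ e * w))) (sym (+-suc k j)))
                       (trans (cong hstep (od-ev k (suc j) w)) (trans (cong hstep (*-assoc 2 (2 ^ j) w)) (hstep-2 _)))
  ex-ev zero j w = refl
  ex-ev (suc k) j w = trans (cong (λ e → ex k (2 ^ e * w) + ifz (par (od k (2 ^ e * w))) 1 0) (sym (+-suc k j)))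
    (trans (cong₂ (λ a b → a + ifz (par b) 1 0) (ex-ev k (suc j) w) (trans (od-ev k (suc j) w) (*-assoc 2 (2 ^ j) w)))
    (trans (cong (λ z → k + ifz z 1 0) (trans (cong par (sym (db≡ (2 ^ j * w)))) (par-db (2 ^ j * w)))) (+-comm k 1)))

  od-odd : ∀ i a m → od (i + a) (2 ^ a * suc (db m)) ≡ suc (db m)
  od-odd zero a m = trans (cong (λ w → od a w) (cong (λ e → 2 ^ e * suc (db m)) (sym (+-identityʳ a)))) (trans (od-ev a 0 _) (+-identityʳ _))
  od-odd (suc i) a m = trans (cong hstep (od-odd i a m)) (hstep-odd m)

  ex-odd : ∀ i a m → ex (i + a) (2 ^ a * suc (db m)) ≡ a
  ex-odd zero a m = trans (cong (λ w → ex a w) (cong (λ e → 2 ^ e * suc (db m)) (sym (+-identityʳ a)))) (ex-ev a 0 _)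
  ex-odd (suc i) a m = trans (cong₂ (λ u w → u + ifz (par w) 1 0) (ex-odd i a m) (od-odd i a m))
                        (trans (cong (λ z → a + ifz z 1 0) (par-sdb m)) (+-identityʳ a))

  -- The exponent a is at most the code, so y iterations always suffice.
  n<2^n : ∀ n → n < 2 ^ n
  n<2^n zero = s≤s z≤n
  n<2^n (suc n) = ≤-trans (s≤s (n<2^n n)) (lem (2 ^ n) (m^n>0 2 n))
    where
    lem : ∀ p → 0 < p → suc p ≤ 2 * p
    lem (suc p) _ = s≤s (subst (suc p ≤_) (sym (+-suc p (p + 0))) (s≤s (m≤m+n p (p + 0))))

  a≤code : ∀ a m → a ≤ 2 ^ a * suc (db m)
  a≤code a m = ≤-trans (<⇒≤ (n<2^n a)) (m≤m*n (2 ^ a) (suc (db m)))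

  hd-dec : ∀ a m → hd (2 ^ a * suc (db m)) ≡ a
  hd-dec a m = trans (cong (λ k → ex k (2 ^ a * suc (db m))) (sym (m∸n+n≡m (a≤code a m)))) (ex-odd (2 ^ a * suc (db m) ∸ a) a m)

  tl-dec : ∀ a m → tl (2 ^ a * suc (db m)) ≡ m
  tl-dec a m = trans (cong (λ k → half (pred (od k (2 ^ a * suc (db m))))) (sym (m∸n+n≡m (a≤code a m))))
               (trans (cong (λ z → half (pred z)) (od-odd (2 ^ a * suc (db m) ∸ a) a m)) (half-db m))

  code-cons : ∀ a s → code (a ∷ s) ≡ 2 ^ a * suc (db (code s))
  code-cons a s = cong (2 ^ a *_) (trans (+-comm (2 * code s) 1) (cong suc (sym (db≡ (code s)))))

  hd-code : ∀ a s → hd (code (a ∷ s)) ≡ a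
  hd-code a s = trans (cong hd (code-cons a s)) (hd-dec a (code s))

  tl-code : ∀ a s → tl (code (a ∷ s)) ≡ code s
  tl-code a s = trans (cong tl (code-cons a s)) (tl-dec a (code s))

  code-pos : ∀ a s → 0 < code (a ∷ s)
  code-pos a s = subst (0 <_) (sym (code-cons a s)) (*-mono-≤ (m^n>0 2 a) (s≤s z≤n))

  code-inj : ∀ σ τ → code σ ≡ code τ → σ ≡ τ
  code-inj [] [] e = refl
  code-inj [] (a ∷ τ) e = ⊥-elim (<-irrefl e (code-pos a τ))
  code-inj (a ∷ σ) [] e = ⊥-elim (<-irrefl (sym e) (code-pos a σ))
  code-inj (a ∷ σ) (b ∷ τ) e =
    cong₂ _∷_ (trans (sym (hd-code a σ)) (trans (cong hd e) (hd-code b τ)))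
              (code-inj σ τ (trans (sym (tl-code a σ)) (trans (cong tl e) (tl-code b τ))))

module StringCodePR where

  open import Defs
  open PrimRep
  open StringCode
  open import Data.Nat
  open import Data.Nat.Properties
  open import Data.Vec using ([]; _∷_; lookup; head)
  open import Relation.Binary.PropositionalEquality
  open import Data.Empty using (⊥-elim)

  rPar : ∀ {o} → Rep o {1} (λ _ v → par (head v))
  rPar = ext {F = Rec (λ _ _ → 0) (λ _ v → ifz (lookup v #1) 1 0)} (rR rZ (rIf (rP #1) (rK 1) (rK 0))) pf
    where
    pf : ∀ x v → Rec (λ _ _ → 0) (λ _ v → ifz (lookup v #1) 1 0) x v ≡ par (head v)
    pf x (zero ∷ []) = refl
    pf x (suc n ∷ []) = cong (λ z → ifz z 1 0) (pf x (n ∷ []))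

  rHalf : ∀ {o} → Rep o {1} (λ _ v → half (head v))
  rHalf = ext {F = Rec (λ _ _ → 0) (λ _ v → lookup v #1 + par (lookup v #0))} (rR rZ (rP #1 ⊕ (rPar · rP #0))) pf
    where
    pf : ∀ x v → Rec (λ _ _ → 0) (λ _ v → lookup v #1 + par (lookup v #0)) x v ≡ half (head v)
    pf x (zero ∷ []) = refl
    pf x (suc n ∷ []) = cong (_+ par n) (pf x (n ∷ []))

  rHstep : ∀ {o} → Rep o {1} (λ _ v → hstep (head v))
  rHstep = ext (rIf (rPar · rP #0) (rHalf · rP #0) (rP #0)) λ { x (y ∷ []) → refl }

  rOd : ∀ {o} → Rep o {2} (λ _ v → od (head v) (lookup v #1))
  rOd = ext {F = Rec (λ _ v → lookup v #0) (λ _ v → hstep (lookup v #1))} (rR (rP #0) (rHstep · rP #1)) pf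
    where
    pf : ∀ x v → Rec (λ _ v → lookup v #0) (λ _ v → hstep (lookup v #1)) x v ≡ od (head v) (lookup v #1)
    pf x (zero ∷ y ∷ []) = refl
    pf x (suc n ∷ y ∷ []) = cong hstep (pf x (n ∷ y ∷ []))

  rEx : ∀ {o} → Rep o {2} (λ _ v → ex (head v) (lookup v #1))
  rEx = ext {F = Rec (λ _ _ → 0) (λ _ v → lookup v #1 + ifz (par (od (lookup v #0) (lookup v #2))) 1 0)}
            (rR rZ (rP #1 ⊕ rIf (rPar · rC rOd (rP #0 ∷ʳ rP #2 ∷ʳ []ʳ)) (rK 1) (rK 0))) pf
    where
    pf : ∀ x v → Rec (λ _ _ → 0) (λ _ v → lookup v #1 + ifz (par (od (lookup v #0) (lookup v #2))) 1 0) x v ≡ ex (head v) (lookup v #1)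
    pf x (zero ∷ y ∷ []) = refl
    pf x (suc n ∷ y ∷ []) = cong (_+ ifz (par (od n y)) 1 0) (pf x (n ∷ y ∷ []))

  rHd : ∀ {o} → Rep o {1} (λ _ v → hd (head v))
  rHd = ext (rC rEx (rP #0 ∷ʳ rP #0 ∷ʳ []ʳ)) λ { x (y ∷ []) → refl }

  rTl : ∀ {o} → Rep o {1} (λ _ v → tl (head v))
  rTl = ext (rHalf · (rPred · rC rOd (rP #0 ∷ʳ rP #0 ∷ʳ []ʳ))) λ { x (y ∷ []) → refl }

  rPow2 : ∀ {o} → Rep o {1} (λ _ v → 2 ^ head v)
  rPow2 = ext {F = Rec (λ _ _ → 1) (λ _ v → 2 * lookup v #1)} (rR (rK 1) (rK 2 ⊗ rP #1)) pf
    where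
    pf : ∀ x v → Rec (λ _ _ → 1) (λ _ v → 2 * lookup v #1) x v ≡ 2 ^ head v
    pf x (zero ∷ []) = refl
    pf x (suc n ∷ []) = cong (2 *_) (pf x (n ∷ []))

  cons : ℕ → ℕ → ℕ
  cons a s = 2 ^ a * (2 * s + 1)

  rCons : ∀ {o} → Rep o {2} (λ _ v → cons (head v) (lookup v #1))
  rCons = ext ((rPow2 · rP #0) ⊗ ((rK 2 ⊗ rP #1) ⊕ rK 1)) λ { x (a ∷ s ∷ []) → refl }

  -- Equality test with values 1 (equal) and 0 (different).
  eqn : ℕ → ℕ → ℕ
  eqn a b = ifz ((a ∸ b) + (b ∸ a)) 1 0

  rEq : ∀ {o} → Rep o {2} (λ _ v → eqn (head v) (lookup v #1))
  rEq = ext (rIf ((rP #0 ⊖ rP #1) ⊕ (rP #1 ⊖ rP #0)) (rK 1) (rK 0)) λ { x (a ∷ b ∷ []) → refl }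

  eqn-refl : ∀ a → eqn a a ≡ 1
  eqn-refl a rewrite n∸n≡0 a = refl

  eqn-sound : ∀ a b → eqn a b ≡ 1 → a ≡ b
  eqn-sound zero zero e = refl
  eqn-sound zero (suc b) ()
  eqn-sound (suc a) zero ()
  eqn-sound (suc a) (suc b) e = cong suc (eqn-sound a b e)

  eqn-ne : ∀ a b → a ≢ b → eqn a b ≡ 0
  eqn-ne zero zero ne = ⊥-elim (ne refl)
  eqn-ne zero (suc b) ne = refl
  eqn-ne (suc a) zero ne = refl
  eqn-ne (suc a) (suc b) ne = eqn-ne a b (λ e → ne (cong suc e))

module StringIndex where

  open import Defs
  open PrimRep
  open StringCode
  open StringCodePR
  open import Data.Nat
  open import Data.Nat.Properties
  open import Data.Vec using ([]; _∷_; lookup; head)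
  open import Data.List using (List; []; _∷_; length; drop; applyUpTo)
  open import Relation.Binary.PropositionalEquality

  tlI : ℕ → ℕ → ℕ
  tlI zero c = c
  tlI (suc i) c = tl (tlI i c)

  nthC : ℕ → ℕ → ℕ
  nthC i c = hd (tlI i c)

  -- The i-th entry of a string, with default 0 outside its length.
  nthL : List ℕ → ℕ → ℕ
  nthL [] i = 0
  nthL (a ∷ s) zero = a
  nthL (a ∷ s) (suc i) = nthL s i

  tailL : List ℕ → List ℕ
  tailL [] = []
  tailL (a ∷ s) = s

  drop-suc : ∀ i (σ : List ℕ) → drop (suc i) σ ≡ tailL (drop i σ)
  drop-suc zero [] = refl
  drop-suc zero (a ∷ σ) = refl
  drop-suc (suc i) [] = refl
  drop-suc (suc i) (a ∷ σ) = drop-suc i σ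

  tl-code' : ∀ σ → tl (code σ) ≡ code (tailL σ)
  tl-code' [] = refl
  tl-code' (a ∷ σ) = tl-code a σ

  tlI-code : ∀ i σ → tlI i (code σ) ≡ code (drop i σ)
  tlI-code zero σ = refl
  tlI-code (suc i) σ = trans (cong tl (tlI-code i σ)) (trans (tl-code' (drop i σ)) (cong code (sym (drop-suc i σ))))

  hd-code' : ∀ σ → hd (code σ) ≡ nthL σ 0
  hd-code' [] = refl
  hd-code' (a ∷ σ) = hd-code a σ

  nthL-drop : ∀ i σ → nthL (drop i σ) 0 ≡ nthL σ i
  nthL-drop zero σ = refl
  nthL-drop (suc i) [] = refl
  nthL-drop (suc i) (a ∷ σ) = nthL-drop i σ

  nthC-code : ∀ i σ → nthC i (code σ) ≡ nthL σ i
  nthC-code i σ = trans (cong hd (tlI-code i σ)) (trans (hd-code' (drop i σ)) (nthL-drop i σ))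

  nthL-app : ∀ (f : ℕ → ℕ) n k → k < n → nthL (applyUpTo f n) k ≡ f k
  nthL-app f (suc n) zero lt = refl
  nthL-app f (suc n) (suc k) (s≤s lt) = nthL-app (λ i → f (suc i)) n k lt

  app-cong : ∀ (f g : ℕ → ℕ) n → (∀ k → k < n → f k ≡ g k) → applyUpTo f n ≡ applyUpTo g n
  app-cong f g zero e = refl
  app-cong f g (suc n) e = cong₂ _∷_ (e 0 (s≤s z≤n)) (app-cong (λ i → f (suc i)) (λ i → g (suc i)) n (λ k lt → e (suc k) (s≤s lt)))

  rTlI : ∀ {o} → Rep o {2} (λ _ v → tlI (head v) (lookup v #1))
  rTlI = ext {F = Rec (λ _ v → lookup v #0) (λ _ v → tl (lookup v #1))} (rR (rP #0) (rTl · rP #1)) pf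
    where
    pf : ∀ x v → Rec (λ _ v → lookup v #0) (λ _ v → tl (lookup v #1)) x v ≡ tlI (head v) (lookup v #1)
    pf x (zero ∷ c ∷ []) = refl
    pf x (suc i ∷ c ∷ []) = cong tl (pf x (i ∷ c ∷ []))

  rNth : ∀ {o} → Rep o {2} (λ _ v → nthC (head v) (lookup v #1))
  rNth = ext (rHd · rTlI) λ { x (i ∷ c ∷ []) → refl }

module StringOps where

  open import Defs
  open PrimRep
  open StringCode
  open StringCodePR
  open StringIndex
  open NatFacts
  open import Data.Nat
  open import Data.Nat.Properties
  open import Data.Vec using (Vec; []; _∷_; lookup; head)
  open import Data.List using (List; []; _∷_; length; drop; take; applyUpTo; _++_; upTo)
  import Data.List.Properties as LP
  open import Data.Product using (_,_)
  open import Data.List.Relation.Unary.All using (All; []; _∷_)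
  open import Relation.Binary.PropositionalEquality
  open import Relation.Nullary using (yes; no)

  -- Signum; cnt j c counts the non-empty tails among the first j tails of c, so
  -- lenC c = cnt c c is the length of the string coded by c.
  sg : ℕ → ℕ
  sg c = ifz c 0 1

  cnt : ℕ → ℕ → ℕ
  cnt zero c = 0
  cnt (suc j) c = cnt j c + sg (tlI j c)

  lenC : ℕ → ℕ
  lenC c = cnt c c

  len≤code : ∀ σ → length σ ≤ code σ
  len≤code [] = z≤n
  len≤code (a ∷ σ) = begin
    suc (length σ)           ≤⟨ s≤s (len≤code σ) ⟩
    1 + code σ               ≡⟨ +-comm 1 (code σ) ⟩
    code σ + 1               ≤⟨ +-monoˡ-≤ 1 (m≤n*m (code σ) 2) ⟩
    2 * code σ + 1           ≤⟨ m≤n*m (2 * code σ + 1) (2 ^ a) {{ >-nonZero (m^n>0 2 a) }} ⟩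
    2 ^ a * (2 * code σ + 1) ∎
    where open ≤-Reasoning

  code-drop-pos : ∀ j σ → j < length σ → sg (code (drop j σ)) ≡ 1
  code-drop-pos zero (a ∷ σ) _ with code (a ∷ σ) | code-pos a σ
  ... | suc _ | _ = refl
  code-drop-pos (suc j) (a ∷ σ) (s≤s lt) = code-drop-pos j σ lt

  code-drop-0 : ∀ j σ → length σ ≤ j → code (drop j σ) ≡ 0
  code-drop-0 j σ le = cong code (LP.drop-all j σ le)

  cnt-code : ∀ j σ → cnt j (code σ) ≡ j ⊓ length σ
  cnt-code zero σ = refl
  cnt-code (suc j) σ with j <? length σ
  ... | yes lt = trans (cong₂ _+_ (cnt-code j σ) (trans (cong sg (tlI-code j σ)) (code-drop-pos j σ lt)))
                                   (trans (cong (_+ 1) (m≤n⇒m⊓n≡m (<⇒≤ lt))) (trans (+-comm j 1) (sym (m≤n⇒m⊓n≡m lt))))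
  ... | no nlt = trans (cong₂ _+_ (cnt-code j σ) (trans (cong sg (tlI-code j σ)) (cong sg (code-drop-0 j σ (≮⇒≥ nlt)))))
                                   (trans (+-identityʳ _) (trans (m≥n⇒m⊓n≡n (≮⇒≥ nlt)) (sym (m≥n⇒m⊓n≡n (≤-trans (≮⇒≥ nlt) (n≤1+n j))))))

  lenC-code : ∀ σ → lenC (code σ) ≡ length σ
  lenC-code σ = trans (cnt-code (code σ) σ) (m≥n⇒m⊓n≡n (len≤code σ))

  -- bld F L i is the code of [F (L ∸ i), …, F (L ∸ 1)]; bldL F L codes [F 0, …, F (L ∸ 1)].
  -- Building the string from the right makes it a primitive recursion on i.
  bld : (ℕ → ℕ) → ℕ → ℕ → ℕ
  bld F L zero = 0
  bld F L (suc i) = cons (F (L ∸ suc i)) (bld F L i)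

  bld-ok : ∀ F L i → i ≤ L → bld F L i ≡ code (applyUpTo (λ k → F (L ∸ i + k)) i)
  bld-ok F L zero le = refl
  bld-ok F L (suc i) le = cong₂ cons (cong F (sym (+-identityʳ _)))
    (trans (bld-ok F L i (≤-trans (n≤1+n i) le))
      (cong code (app-cong _ _ i (λ k _ → cong F (trans (cong (_+ k) (sym (sub-suc L i le))) (sym (+-suc (L ∸ suc i) k)))))))

  bldL : (ℕ → ℕ) → ℕ → ℕ
  bldL F L = bld F L L

  bldL-ok : ∀ F L → bldL F L ≡ code (applyUpTo F L)
  bldL-ok F L = trans (bld-ok F L L ≤-refl) (cong code (app-cong _ F L (λ k _ → cong F (cong (_+ k) (n∸n≡0 L)))))

  rBld : ∀ {o} {F : ℕ → ℕ → ℕ} → Rep o {2} (λ _ v → F (head v) (lookup v #1)) →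
         Rep o {2} (λ _ v → bldL (λ p → F p (lookup v #1)) (head v))
  rBld {o} {F} rF = ext (rC inner (rP #0 ∷ʳ rP #0 ∷ʳ rP #1 ∷ʳ []ʳ)) λ { x (L ∷ e ∷ []) → pf x L L e }
    where
    H : Fn 4
    H = λ (_ : ℕ → ℕ) (v : Vec ℕ 4) → cons (F (lookup v #2 ∸ suc (lookup v #0)) (lookup v #3)) (lookup v #1)
    inner : Rep o {3} (Rec (λ _ _ → 0) H)
    inner = rR rZ (rC rCons (rC rF ((rP #2 ⊖ rS · rP #0) ∷ʳ rP #3 ∷ʳ []ʳ) ∷ʳ rP #1 ∷ʳ []ʳ))
    pf : ∀ x i L e → Rec (λ _ _ → 0) H x (i ∷ L ∷ e ∷ []) ≡ bld (λ p → F p e) L i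
    pf x zero L e = refl
    pf x (suc i) L e = cong (cons (F (L ∸ suc i) e)) (pf x i L e)

  min∸ : ∀ a b → a ∸ (a ∸ b) ≡ a ⊓ b
  min∸ a b with b ≤? a
  ... | yes b≤a = trans (m∸[m∸n]≡n b≤a) (sym (m≥n⇒m⊓n≡n b≤a))
  ... | no b≰a = trans (cong (a ∸_) (m≤n⇒m∸n≡0 a≤b)) (sym (m≤n⇒m⊓n≡m a≤b))
    where
    a≤b : a ≤ b
    a≤b = <⇒≤ (≰⇒> b≰a)

  takeC : ℕ → ℕ → ℕ
  takeC j e = bldL (λ k → nthC k e) (j ⊓ lenC e)

  take-app : ∀ j (σ : List ℕ) → take j σ ≡ applyUpTo (nthL σ) (j ⊓ length σ)
  take-app zero σ = refl
  take-app (suc j) [] = refl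
  take-app (suc j) (a ∷ σ) = cong (a ∷_) (take-app j σ)

  takeC-ok : ∀ j σ → takeC j (code σ) ≡ code (take j σ)
  takeC-ok j σ = trans (cong (λ L → bldL (λ k → nthC k (code σ)) (j ⊓ L)) (lenC-code σ))
    (trans (bldL-ok (λ k → nthC k (code σ)) (j ⊓ length σ)) (cong code (trans (app-cong _ (nthL σ) (j ⊓ length σ) (λ k _ → nthC-code k σ)) (sym (take-app j σ)))))

  rSg : ∀ {o} → Rep o {1} (λ _ v → sg (head v))
  rSg = ext (rIf (rP #0) (rK 0) (rK 1)) λ { x (c ∷ []) → refl }

  rCnt : ∀ {o} → Rep o {2} (λ _ v → cnt (head v) (lookup v #1))
  rCnt = ext {F = Rec (λ _ _ → 0) (λ _ v → lookup v #1 + sg (tlI (lookup v #0) (lookup v #2)))}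
             (rR rZ (rP #1 ⊕ rSg · rC rTlI (rP #0 ∷ʳ rP #2 ∷ʳ []ʳ))) pf
    where
    pf : ∀ x v → Rec (λ _ _ → 0) (λ _ v → lookup v #1 + sg (tlI (lookup v #0) (lookup v #2))) x v ≡ cnt (head v) (lookup v #1)
    pf x (zero ∷ c ∷ []) = refl
    pf x (suc j ∷ c ∷ []) = cong (_+ sg (tlI j c)) (pf x (j ∷ c ∷ []))

  rLenC : ∀ {o} → Rep o {1} (λ _ v → lenC (head v))
  rLenC = ext (rC rCnt (rP #0 ∷ʳ rP #0 ∷ʳ []ʳ)) λ { x (c ∷ []) → refl }

  rMin : ∀ {o} → Rep o {2} (λ _ v → head v ⊓ lookup v #1)
  rMin = ext (rP #0 ⊖ (rP #0 ⊖ rP #1)) λ { x (a ∷ b ∷ []) → min∸ a b }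

  rTakeC : ∀ {o} → Rep o {2} (λ _ v → takeC (head v) (lookup v #1))
  rTakeC = ext (rC (rBld {F = nthC} rNth) (rC rMin (rP #0 ∷ʳ rLenC · rP #1 ∷ʳ []ʳ) ∷ʳ rP #1 ∷ʳ []ʳ)) λ { x (j ∷ e ∷ []) → refl }

  code-take-le : ∀ j σ → code (take j σ) ≤ code σ
  code-take-le zero σ = z≤n
  code-take-le (suc j) [] = z≤n
  code-take-le (suc j) (a ∷ σ) = *-monoʳ-≤ (2 ^ a) (+-monoˡ-≤ 1 (*-monoʳ-≤ 2 (code-take-le j σ)))

  code-bound : ∀ B σ → All (λ a → a ≤ B) σ → code σ < 2 ^ ((B + 1) * length σ)
  code-bound B [] al = subst (λ z → 1 ≤ 2 ^ z) (sym (*-zeroʳ (B + 1))) (s≤s z≤n)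
  code-bound B (a ∷ σ) (le ∷ al) = ≤-trans (s≤s step1) (≤-reflexive eqv)
    where
    X : ℕ
    X = (B + 1) * length σ
    c : ℕ
    c = code σ
    ih : suc c ≤ 2 ^ X
    ih = code-bound B σ al
    step0 : 2 * c + 1 < 2 * 2 ^ X
    step0 = ≤-trans (≤-reflexive (cong suc (+-comm (2 * c) 1))) (≤-trans (≤-reflexive (sym (*-suc 2 c))) (*-monoʳ-≤ 2 ih))
    ≤-pred' : ∀ {u w} → u < w → u ≤ w ∸ 1
    ≤-pred' {u} {suc w} (s≤s le) = le
    step1 : 2 ^ a * (2 * c + 1) ≤ 2 ^ B * (2 * 2 ^ X) ∸ 1
    step1 = ≤-trans (*-monoˡ-≤ (2 * c + 1) (^-monoʳ-≤ 2 le))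
             (≤-trans (*-monoʳ-≤ (2 ^ B) (≤-pred' step0)) (≤-trans (≤-reflexive (*-distribˡ-∸ (2 ^ B) (2 * 2 ^ X) 1)) (∸-monoʳ-≤ (2 ^ B * (2 * 2 ^ X)) (≤-trans (m^n>0 2 B) (≤-reflexive (sym (*-identityʳ (2 ^ B))))))))
    eqv : suc (2 ^ B * (2 * 2 ^ X) ∸ 1) ≡ 2 ^ ((B + 1) * suc (length σ))
    eqv = trans (m∸n+n≡m' _ (*-mono-≤ (m^n>0 2 B) (≤-trans (m^n>0 2 X) (m≤n*m (2 ^ X) 2)))) (trans (sym (*-assoc (2 ^ B) 2 (2 ^ X))) (trans (cong (_* 2 ^ X) (*-comm (2 ^ B) 2))
            (trans (sym (^-distribˡ-+-* 2 (suc B) X)) (cong (2 ^_) (trans (cong (_+ X) (+-comm 1 B)) (sym (*-suc (B + 1) (length σ))))))))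
      where
      m∸n+n≡m' : ∀ u → 0 < u → suc (u ∸ 1) ≡ u
      m∸n+n≡m' (suc u) _ = refl

  allApp : ∀ {P : ℕ → Set} (F : ℕ → ℕ) n → (∀ k → P (F k)) → All P (applyUpTo F n)
  allApp F zero h = []
  allApp F (suc n) h = h 0 ∷ allApp (λ k → F (suc k)) n (λ k → h (suc k))

  app-split : ∀ (F : ℕ → ℕ) a b → applyUpTo F (a + b) ≡ applyUpTo F a ++ applyUpTo (λ i → F (a + i)) b
  app-split F zero b = refl
  app-split F (suc a) b = cong (F 0 ∷_) (app-split (λ i → F (suc i)) a b)

  take-++ : ∀ j (σ w : List ℕ) → j ≤ length σ → take j (σ ++ w) ≡ take j σ
  take-++ zero σ w le = refl
  take-++ (suc j) (a ∷ σ) w (s≤s le) = cong (a ∷_) (take-++ j σ w le)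

  nthL-++ : ∀ (s w : List ℕ) k → k < length s → nthL (s ++ w) k ≡ nthL s k
  nthL-++ (a ∷ s) w zero lt = refl
  nthL-++ (a ∷ s) w (suc k) (s≤s lt) = nthL-++ s w k lt

  len↾ : ∀ x L → length (x ↾ L) ≡ L
  len↾ x L = trans (LP.length-map x (upTo L)) (LP.length-upTo L)

module Machine where

  open import Defs
  open import Data.Nat
  open import Data.Nat.Properties
  open import Data.Nat.Tactic.RingSolver
  open import Data.Bool using (true; false; if_then_else_; T)
  open import Data.List using (List; []; _∷_; _++_; length)
  open import Data.Maybe using (just; nothing)
  open import Data.Unit using (⊤; tt)
  open import Data.Empty using (⊥-elim)
  open import Data.Product using (_,_; proj₁; proj₂; _×_; ∃-syntax)
  open import Relation.Binary.PropositionalEquality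
  open import Relation.Nullary using (yes; no)

  upd-eq : ∀ ρ r v → update ρ r v r ≡ v
  upd-eq ρ r v with r ≡ᵇ r | ≡⇒≡ᵇ r r refl
  ... | true | _ = refl

  upd-ne : ∀ ρ r v k → k ≢ r → update ρ r v k ≡ ρ k
  upd-ne ρ r v k ne with k ≡ᵇ r | ≡ᵇ⇒≡ k r
  ... | true | f = ⊥-elim (ne (f tt))
  ... | false | _ = refl

  upd-cong : ∀ {ρ1 ρ2 : ℕ → ℕ} r {v1 v2} → (∀ k → ρ1 k ≡ ρ2 k) → v1 ≡ v2 → ∀ k → update ρ1 r v1 k ≡ update ρ2 r v2 k
  upd-cong r e refl k with k ≡ᵇ r
  ... | true = refl
  ... | false = e k

  -- Register updates are kept opaque so that proofs proceed through the two
  -- reading laws U= and U≠ rather than by unfolding the Boolean test.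
  opaque
    set : (ℕ → ℕ) → ℕ → ℕ → ℕ → ℕ
    set = update
    set≡ : ∀ ρ r v k → update ρ r v k ≡ set ρ r v k
    set≡ _ _ _ _ = refl
    U= : ∀ {ρ r v} → set ρ r v r ≡ v
    U= {ρ} {r} {v} = upd-eq ρ r v
    U≠ : ∀ {ρ r v k} → k ≢ r → set ρ r v k ≡ ρ k
    U≠ {ρ} {r} {v} {k} = upd-ne ρ r v k

  set-cong : ∀ {ρ1 ρ2 : ℕ → ℕ} r {v1 v2} → (∀ k → ρ1 k ≡ ρ2 k) → v1 ≡ v2 → ∀ k → set ρ1 r v1 k ≡ set ρ2 r v2 k
  set-cong r e refl k with k ≟ r
  ... | yes refl = trans U= (sym U=)
  ... | no ne = trans (U≠ ne) (trans (e k) (sym (U≠ ne)))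

  run-add : ∀ x M a b c → run x M (a + b) c ≡ run x M a (run x M b c)
  run-add x M zero b c = refl
  run-add x M (suc a) b c = cong (step x M) (run-add x M a b c)

  step-just : ∀ x M c i → fetch M (pc c) ≡ just i → step x M c ≡ exec x i c
  step-just x M c i f with fetch M (pc c)
  step-just x M c i refl | .(just i) = refl

  step-halt : ∀ x M c → Halted M c → step x M c ≡ c
  step-halt x M c h with fetch M (pc c)
  step-halt x M c refl | .nothing = refl

  run-halt : ∀ x M s c → Halted M c → run x M s c ≡ c
  run-halt x M zero c h = refl
  run-halt x M (suc s) c h = trans (cong (step x M) (run-halt x M s c h)) (step-halt x M c h)

  Exec : (ℕ → ℕ) → Program → ℕ → (ℕ → ℕ) → ℕ → (ℕ → ℕ) → ℕ → ℕ → Set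
  Exec x M p ρ p' ρ' T Q = ∀ c → pc c ≡ p → (∀ k → reg c k ≡ ρ k) →
    ∃[ s ] (s ≤ T × pc (run x M s c) ≡ p' × (∀ k → reg (run x M s c) k ≡ ρ' k)
            × (∀ i → i < s → QueryBelow M (run x M i c) Q))

  ex-refl : ∀ {x M p ρ ρ' T Q} → (∀ k → ρ k ≡ ρ' k) → Exec x M p ρ p ρ' T Q
  ex-refl e c pc≡ r≡ = 0 , z≤n , pc≡ , (λ k → trans (r≡ k) (e k)) , (λ i ())

  ex-mono : ∀ {x M p ρ p' ρ' T Q T' Q'} → T ≤ T' → Q ≤ Q' → Exec x M p ρ p' ρ' T Q → Exec x M p ρ p' ρ' T' Q'
  ex-mono tt' qq' E c a b with E c a b
  ... | s , s≤ , e1 , e2 , qb = s , ≤-trans s≤ tt' , e1 , e2 , (λ i i<s r s' f → ≤-trans (qb i i<s r s' f) qq')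

  ex-Teq : ∀ {x M p ρ p' ρ' T Q T'} → T ≡ T' → Exec x M p ρ p' ρ' T Q → Exec x M p ρ p' ρ' T' Q
  ex-Teq refl E = E

  ex-post : ∀ {x M p ρ p' ρ' ρ'' T Q} → (∀ k → ρ' k ≡ ρ'' k) → Exec x M p ρ p' ρ' T Q → Exec x M p ρ p' ρ'' T Q
  ex-post e E c a b with E c a b
  ... | s , s≤ , e1 , e2 , qb = s , s≤ , e1 , (λ k → trans (e2 k) (e k)) , qb

  ex-pre : ∀ {x M p ρ ρ0 p' ρ' T Q} → (∀ k → ρ0 k ≡ ρ k) → Exec x M p ρ p' ρ' T Q → Exec x M p ρ0 p' ρ' T Q
  ex-pre e E c a b = E c a (λ k → trans (b k) (e k))

  ex-seq : ∀ {x M p ρ p1 ρ1 p2 ρ2 T1 T2 Q} → Exec x M p ρ p1 ρ1 T1 Q → Exec x M p1 ρ1 p2 ρ2 T2 Q →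
           Exec x M p ρ p2 ρ2 (T1 + T2) Q
  ex-seq {x} {M} {T1 = T1} E1 E2 c a b with E1 c a b
  ... | s1 , s1≤ , e1 , e2 , qb1 with E2 (run x M s1 c) e1 e2
  ... | s2 , s2≤ , f1 , f2 , qb2 =
    s2 + s1 , ≤-trans (≤-reflexive (+-comm s2 s1)) (+-mono-≤ s1≤ s2≤) ,
    subst (λ c' → pc c' ≡ _) (sym (run-add x M s2 s1 c)) f1 ,
    (λ k → subst (λ c' → reg c' k ≡ _) (sym (run-add x M s2 s1 c)) (f2 k)) ,
    qb
    where
    qb : ∀ i → i < s2 + s1 → QueryBelow M (run x M i c) _
    qb i i< with i <? s1
    ... | yes i<s1 = qb1 i i<s1
    ... | no i≮s1 = subst (λ c' → QueryBelow M c' _) (trans (sym (run-add x M (i ∸ s1) s1 c)) (cong (λ z → run x M z c) (m∸n+n≡m (≮⇒≥ i≮s1))))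
                      (qb2 (i ∸ s1) (+-cancelʳ-< s1 (i ∸ s1) s2 (subst (_< s2 + s1) (sym (m∸n+n≡m (≮⇒≥ i≮s1))) i<)))

  exec-dec0 : ∀ x r j c → reg c r ≡ 0 → exec x (decjz r j) c ≡ ⟨ j , reg c ⟩
  exec-dec0 x r j c e with reg c r
  exec-dec0 x r j c refl | .0 = refl

  exec-decS : ∀ x r j c n → reg c r ≡ suc n → exec x (decjz r j) c ≡ ⟨ suc (pc c) , update (reg c) r n ⟩
  exec-decS x r j c n e with reg c r
  exec-decS x r j c n refl | .(suc n) = refl

  one : ∀ {x M p ρ p' ρ' Q} i → fetch M p ≡ just i →
        (∀ c → pc c ≡ p → (∀ k → reg c k ≡ ρ k) → pc (exec x i c) ≡ p' × (∀ k → reg (exec x i c) k ≡ ρ' k)) →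
        QueryBelow M ⟨ p , ρ ⟩ Q →
        Exec x M p ρ p' ρ' 1 Q
  one {x} {M} {p} {ρ} i f h q c refl b =
    1 , ≤-refl ,
    subst (λ c' → pc c' ≡ _) (sym (step-just x M c i f)) (proj₁ (h c refl b)) ,
    (λ k → subst (λ c' → reg c' k ≡ _) (sym (step-just x M c i f)) (proj₂ (h c refl b) k)) ,
    λ { zero _ r s f' → subst (_< _) (sym (b s)) (q r s f') ; (suc i) (s≤s ()) }

  noQ : ∀ {M p ρ Q} i → fetch M p ≡ just i → (∀ r s → i ≢ query r s) → QueryBelow M ⟨ p , ρ ⟩ Q
  noQ i f nq r s f' = ⊥-elim (nq r s (just-inj (trans (sym f) f')))
    where
    just-inj : ∀ {a b : Instr} → just a ≡ just b → a ≡ b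
    just-inj refl = refl

  i-inc : ∀ {x M p ρ Q} r → fetch M p ≡ just (inc r) → Exec x M p ρ (suc p) (set ρ r (suc (ρ r))) 1 Q
  i-inc {x} {M} {p} r f = one (inc r) f (λ c pc≡ b → cong suc pc≡ , λ k → trans (upd-cong r b (cong suc (b r)) k) (set≡ _ r _ k)) (noQ {M = M} {p = p} (inc r) f (λ _ _ ()))

  i-dec0 : ∀ {x M p ρ Q} r j → fetch M p ≡ just (decjz r j) → ρ r ≡ 0 → Exec x M p ρ j ρ 1 Q
  i-dec0 {x} {M} {p} r j f z = one (decjz r j) f (λ c pc≡ b → cong pc (exec-dec0 x r j c (trans (b r) z)) ,
                                     λ k → trans (cong (λ c' → reg c' k) (exec-dec0 x r j c (trans (b r) z))) (b k))
                        (noQ {M = M} {p = p} (decjz r j) f (λ _ _ ()))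

  i-decS : ∀ {x M p ρ Q} r j n → fetch M p ≡ just (decjz r j) → ρ r ≡ suc n → Exec x M p ρ (suc p) (set ρ r n) 1 Q
  i-decS {x} {M} {p} r j n f z = one (decjz r j) f (λ c pc≡ b → trans (cong pc (exec-decS x r j c n (trans (b r) z))) (cong suc pc≡) ,
                                     λ k → trans (cong (λ c' → reg c' k) (exec-decS x r j c n (trans (b r) z))) (trans (upd-cong r b refl k) (set≡ _ r _ k)))
                        (noQ {M = M} {p = p} (decjz r j) f (λ _ _ ()))

  i-query : ∀ {x M p ρ Q} r s → fetch M p ≡ just (query r s) → ρ s < Q → Exec x M p ρ (suc p) (set ρ r (x (ρ s))) 1 Q
  i-query {x} {M} {p} {ρ} r s f lt =
    one (query r s) f (λ c pc≡ b → cong suc pc≡ , λ k → trans (upd-cong r b (cong x (b s)) k) (set≡ _ r _ k))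
        (λ r' s' f' → subst (λ z → ρ z < _) (sym (q-inj (trans (sym f) f'))) lt)
    where
    q-inj : ∀ {r s r' s'} → just (query r s) ≡ just (query r' s') → s' ≡ s
    q-inj refl = refl

  At : Program → ℕ → List Instr → Set
  At M p [] = ⊤
  At M p (i ∷ is) = fetch M p ≡ just i × At M (suc p) is

  at-++ : ∀ M p xs ys → At M p (xs ++ ys) → At M p xs × At M (p + length xs) ys
  at-++ M p [] ys a = tt , subst (λ q → At M q ys) (sym (+-identityʳ p)) a
  at-++ M p (i ∷ xs) ys (f , a) with at-++ M (suc p) xs ys a
  ... | a1 , a2 = (f , a1) , subst (λ q → At M q ys) (sym (+-suc p (length xs))) a2

  at-shift : ∀ i M p is → At M p is → At (i ∷ M) (suc p) is
  at-shift i M p [] a = tt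
  at-shift i M p (j ∷ is) (f , a) = f , at-shift i M (suc p) is a

  at-self : ∀ M → At M 0 M
  at-self [] = tt
  at-self (i ∷ M) = refl , at-shift i M 0 M (at-self M)

  at-get : ∀ M p is j i → At M p is → fetch is j ≡ just i → fetch M (p + j) ≡ just i
  at-get M p [] j i a ()
  at-get M p (i' ∷ is) zero i (f , a) e = trans (cong (fetch M) (+-identityʳ p)) (trans f e)
  at-get M p (i' ∷ is) (suc j) i (f , a) e = trans (cong (fetch M) (+-suc p j)) (at-get M (suc p) is j i a e)

  ex-pc : ∀ {x M p ρ p' ρ' T Q q q'} → p ≡ q → p' ≡ q' → Exec x M p ρ p' ρ' T Q → Exec x M q ρ q' ρ' T Q
  ex-pc refl refl E = E

  -- The counting loop  p: decjz r E; body; decjz zr p  (zr an always-zero register):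
  -- if the body turns Sf (n+1) with r decremented into Sf n, the loop turns Sf v into
  -- Sf 0 in time v * (tb + 2) + 1.
  loop : ∀ {x M p Q} r zr lb tb E (Sf : ℕ → ℕ → ℕ) →
         fetch M p ≡ just (decjz r E) →
         fetch M (p + suc lb) ≡ just (decjz zr p) →
         (∀ n → Sf n r ≡ n) → (∀ n → Sf n zr ≡ 0) → ∀ v →
         (∀ n → n < v → Exec x M (p + 1) (set (Sf (suc n)) r n) (p + suc lb) (Sf n) tb Q) →
         Exec x M p (Sf v) E (Sf 0) (v * (tb + 2) + 1) Q
  loop r zr lb tb E Sf f1 f2 Sr Sz zero body = i-dec0 r _ f1 (Sr 0)
  loop {p = p} r zr lb tb E Sf f1 f2 Sr Sz (suc n) body =
    ex-Teq (lem n tb)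
      (ex-seq (ex-seq (ex-seq (ex-pc refl (+-comm 1 p) (i-decS r _ n f1 (Sr (suc n)))) (body n ≤-refl)) (i-dec0 zr p f2 (Sz n)))
              (loop r zr lb tb E Sf f1 f2 Sr Sz n (λ m m<n → body m (≤-trans m<n (n≤1+n n)))))
    where
    lem : ∀ n tb → ((1 + tb) + 1) + (n * (tb + 2) + 1) ≡ suc n * (tb + 2) + 1
    lem = solve-∀

module MachineBlocks where

  open import Defs
  open Machine
  open NatFacts
  open import Data.Nat
  open import Data.Nat.Properties
  open import Data.Nat.Tactic.RingSolver
  open import Data.List using ([]; _∷_)
  open import Data.Product using (proj₁; proj₂)
  open import Relation.Binary.PropositionalEquality
  open import Relation.Nullary using (yes; no)

  set-set : ∀ ρ r a b k → set (set ρ r a) r b k ≡ set ρ r b k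
  set-set ρ r a b k with k ≟ r
  ... | yes refl = trans U= (sym U=)
  ... | no ne = trans (U≠ ne) (trans (U≠ ne) (sym (U≠ ne)))

  set-self : ∀ ρ r k → ρ k ≡ set ρ r (ρ r) k
  set-self ρ r k with k ≟ r
  ... | yes refl = sym U=
  ... | no ne = sym (U≠ ne)

  clearC : ℕ → ℕ → Program
  clearC r p = decjz r (p + 2) ∷ decjz 1 p ∷ []

  clear-ex : ∀ {x M p ρ Q} r → At M p (clearC r p) → ρ 1 ≡ 0 → r ≢ 1 →
             Exec x M p ρ (p + 2) (set ρ r 0) (ρ r * 2 + 1) Q
  clear-ex {x} {M} {p} {ρ} r a z r≢1 =
    ex-pre (set-self ρ r)
      (loop r 1 0 0 (p + 2) (set ρ r) (proj₁ a) (at-get M p (clearC r p) 1 _ a refl)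
        (λ n → U=) (λ n → trans (U≠ (≢-sym r≢1)) z) (ρ r)
        (λ n _ → ex-refl (set-set ρ r (suc n) n)))

  transferC : ℕ → ℕ → ℕ → Program
  transferC r d p = decjz r (p + 3) ∷ inc d ∷ decjz 1 p ∷ []

  transfer-ex : ∀ {x M p ρ Q} r d → At M p (transferC r d p) → ρ 1 ≡ 0 → r ≢ d → r ≢ 1 → d ≢ 1 →
                Exec x M p ρ (p + 3) (set (set ρ r 0) d (ρ d + ρ r)) (ρ r * 3 + 1) Q
  transfer-ex {x} {M} {p} {ρ} r d a z r≢d r≢1 d≢1 =
    ex-pre pre
      (loop r 1 1 1 (p + 3) Sf (proj₁ a) (at-get M p (transferC r d p) 2 _ a refl)
        (λ n → trans (U≠ r≢d) U=)
        (λ n → trans (U≠ (≢-sym d≢1)) (trans (U≠ (≢-sym r≢1)) z)) v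
        body)
    where
    v : ℕ
    v = ρ r
    Sf : ℕ → ℕ → ℕ
    Sf n = set (set ρ r n) d (ρ d + (v ∸ n))
    pre : ∀ k → ρ k ≡ Sf v k
    pre k with k ≟ d
    ... | yes refl = sym (trans U= (trans (cong (ρ d +_) (n∸n≡0 v)) (+-identityʳ _)))
    ... | no ne = trans (set-self ρ r k) (sym (U≠ ne))
    body : ∀ n → n < v → Exec x M (p + 1) (set (Sf (suc n)) r n) (p + suc 1) (Sf n) 1 _
    body n lt = ex-pc refl (sym (+-suc p 1)) (ex-post pw (i-inc d (at-get M p (transferC r d p) 1 _ a refl)))
      where
      pw : ∀ k → set (set (Sf (suc n)) r n) d (suc (set (Sf (suc n)) r n d)) k ≡ Sf n k
      pw k with k ≟ d
      ... | yes refl = trans U= (trans (cong suc (trans (U≠ (≢-sym r≢d)) U=))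
                         (trans (sym (+-suc (ρ d) _)) (trans (cong (ρ d +_) (sub-suc v n lt)) (sym U=))))
      ... | no ne with k ≟ r
      ...   | yes refl = trans (U≠ ne) (trans U= (sym (trans (U≠ ne) U=)))
      ...   | no ne' = trans (U≠ ne) (trans (U≠ ne') (trans (U≠ ne) (trans (U≠ ne') (sym (trans (U≠ ne) (U≠ ne'))))))

  addcopyC : ℕ → ℕ → ℕ → ℕ → Program
  addcopyC a d t p = decjz a (p + 4) ∷ inc d ∷ inc t ∷ decjz 1 p ∷ transferC t a (p + 4)

  addcopy-ex : ∀ {x M p ρ Q} a d t → At M p (addcopyC a d t p) → ρ 1 ≡ 0 → ρ t ≡ 0 →
               a ≢ d → a ≢ t → d ≢ t → a ≢ 1 → d ≢ 1 → t ≢ 1 →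
               Exec x M p ρ (p + 7) (set ρ d (ρ d + ρ a)) (ρ a * 4 + 1 + (ρ a * 3 + 1)) Q
  addcopy-ex {x} {M} {p} {ρ} a d t at z zt a≢d a≢t d≢t a≢1 d≢1 t≢1 =
    ex-pc refl (+-assoc p 4 3)
     (ex-post fin (ex-Teq (cong (λ w → v * (2 + 2) + 1 + (w * 3 + 1)) U=)
      (ex-seq
       (ex-pre pre
        (loop a 1 2 2 (p + 4) Sf (proj₁ at) (at-get M p (addcopyC a d t p) 3 _ at refl)
          (λ n → trans (U≠ a≢t) (trans (U≠ a≢d) U=))
          (λ n → trans (U≠ (≢-sym t≢1)) (trans (U≠ (≢-sym d≢1)) (trans (U≠ (≢-sym a≢1)) z))) v
          body))
       (transfer-ex t a (proj₂ (at-++ M p (decjz a (p + 4) ∷ inc d ∷ inc t ∷ decjz 1 p ∷ []) (transferC t a (p + 4)) at))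
          (trans (U≠ (≢-sym t≢1)) (trans (U≠ (≢-sym d≢1)) (trans (U≠ (≢-sym a≢1)) z))) (≢-sym a≢t) t≢1 a≢1))))
    where
    v : ℕ
    v = ρ a
    -- Loop invariant with n iterations to go: a = n, and d and t have both
    -- received v ∸ n increments.  Afterwards t is transferred back into a.
    Sf : ℕ → ℕ → ℕ
    Sf n = set (set (set ρ a n) d (ρ d + (v ∸ n))) t (v ∸ n)
    pre : ∀ k → ρ k ≡ Sf v k
    pre k with k ≟ t
    ... | yes refl = trans zt (sym (trans U= (n∸n≡0 v)))
    ... | no ne with k ≟ d
    ...   | yes refl = sym (trans (U≠ ne) (trans U= (trans (cong (ρ d +_) (n∸n≡0 v)) (+-identityʳ _))))
    ...   | no ne' = trans (set-self ρ a k) (sym (trans (U≠ ne) (U≠ ne')))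
    body : ∀ n → n < v → Exec x M (p + 1) (set (Sf (suc n)) a n) (p + suc 2) (Sf n) 2 _
    body n lt = ex-pc refl (lem p) (ex-post pw (ex-seq (i-inc d (at-get M p (addcopyC a d t p) 1 _ at refl))
                                                        (ex-pc (+-suc p 1) refl (i-inc t (at-get M p (addcopyC a d t p) 2 _ at refl)))))
      where
      lem : ∀ p → suc (p + 2) ≡ p + 3
      lem p = sym (+-suc p 2)
      B : ℕ → ℕ
      B = set (Sf (suc n)) a n
      pw : ∀ k → set (set B d (suc (B d))) t (suc (set B d (suc (B d)) t)) k ≡ Sf n k
      pw k with k ≟ t
      ... | yes refl = trans U= (trans (cong suc (trans (U≠ (≢-sym d≢t)) (trans (U≠ (≢-sym a≢t)) U=))) (trans (sub-suc v n lt) (sym U=)))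
      ... | no ne with k ≟ d
      ...   | yes refl = trans (U≠ ne) (trans U= (trans (cong suc (trans (U≠ (≢-sym a≢d)) (trans (U≠ ne) U=)))
                           (trans (sym (+-suc (ρ d) _)) (trans (cong (ρ d +_) (sub-suc v n lt)) (sym (trans (U≠ ne) U=))))))
      ...   | no ne' with k ≟ a
      ...     | yes refl = trans (U≠ ne) (trans (U≠ ne') (trans U= (sym (trans (U≠ ne) (trans (U≠ ne') U=)))))
      ...     | no ne'' = trans (U≠ ne) (trans (U≠ ne') (trans (U≠ ne'') (trans (U≠ ne) (trans (U≠ ne') (trans (U≠ ne'')
                            (sym (trans (U≠ ne) (trans (U≠ ne') (U≠ ne'')))))))))
    S0 : ℕ → ℕ
    S0 = Sf 0
    fin : ∀ k → set (set S0 t 0) a (S0 a + S0 t) k ≡ set ρ d (ρ d + ρ a) k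
    fin k with k ≟ a
    ... | yes refl = trans U= (trans (cong₂ _+_ (trans (U≠ a≢t) (trans (U≠ a≢d) U=)) U=) (sym (U≠ a≢d)))
    ... | no ne with k ≟ t
    ...   | yes refl = trans (U≠ ne) (trans U= (trans (sym zt) (sym (U≠ (≢-sym d≢t)))))
    ...   | no ne' with k ≟ d
    ...     | yes refl = trans (U≠ ne) (trans (U≠ ne') (trans (U≠ ne') (trans U= (sym U=))))
    ...     | no ne'' = trans (U≠ ne) (trans (U≠ ne') (trans (U≠ ne') (trans (U≠ ne'') (trans (U≠ ne) (sym (U≠ ne''))))))

module RegisterRuns where

  open import Defs
  open import Data.Nat
  open import Data.Nat.Properties
  open import Data.List using (List; []; _∷_)
  open import Data.List.Relation.Unary.All using (All; []; _∷_)
  open import Data.Product using (_×_; _,_)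
  open import Data.Maybe using (just; nothing)
  open import Relation.Binary.PropositionalEquality

  InsOK : ℕ → Instr → Set
  InsOK R (inc r) = r < R
  InsOK R (decjz r j) = r < R
  InsOK R (query r s) = r < R × s < R

  mx : Instr → ℕ
  mx (inc r) = r
  mx (decjz r j) = r
  mx (query r s) = r ⊔ s

  Rm : Program → ℕ
  Rm [] = 1
  Rm (i ∷ M) = suc (mx i) ⊔ Rm M

  ok-mono : ∀ {R R'} i → R ≤ R' → InsOK R i → InsOK R' i
  ok-mono (inc r) le lt = ≤-trans lt le
  ok-mono (decjz r j) le lt = ≤-trans lt le
  ok-mono (query r s) le (a , b) = ≤-trans a le , ≤-trans b le

  ok-mx : ∀ i → InsOK (suc (mx i)) i
  ok-mx (inc r) = ≤-refl
  ok-mx (decjz r j) = ≤-refl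
  ok-mx (query r s) = s≤s (m≤m⊔n r s) , s≤s (m≤n⊔m r s)

  allOK : ∀ M → All (InsOK (Rm M)) M
  allOK [] = []
  allOK (i ∷ M) = ok-mono i (m≤m⊔n _ (Rm M)) (ok-mx i) ∷ Data.List.Relation.Unary.All.map (λ {j} → ok-mono j (m≤n⊔m (suc (mx i)) (Rm M))) (allOK M)

  Rm-pos : ∀ M → 0 < Rm M
  Rm-pos [] = s≤s z≤n
  Rm-pos (i ∷ M) = ≤-trans (s≤s z≤n) (m≤m⊔n (suc (mx i)) (Rm M))

  open Machine using (run-add; run-halt; step-just; step-halt; exec-dec0; exec-decS)

  run-tn : ∀ x M s T c → s ≤ T → Halted M (run x M s c) → run x M T c ≡ run x M s c
  run-tn x M s T c le h = trans (cong (λ z → run x M z c) (sym (m∸n+n≡m le)))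
                            (trans (run-add x M (T ∸ s) s c) (run-halt x M (T ∸ s) _ h))

  step-agree : ∀ x y M c Q → QueryBelow M c Q → (∀ p → p < Q → y p ≡ x p) → step y M c ≡ step x M c
  step-agree x y M c Q qb ag = st (fetch M (pc c)) refl
    where
    st : ∀ m → fetch M (pc c) ≡ m → step y M c ≡ step x M c
    st nothing e = trans (step-halt y M c e) (sym (step-halt x M c e))
    st (just (inc r)) e = trans (step-just y M c _ e) (sym (step-just x M c _ e))
    st (just (decjz r j)) e = trans (step-just y M c _ e) (trans (dj (reg c r) refl) (sym (step-just x M c _ e)))
      where
      dj : ∀ w → reg c r ≡ w → exec y (decjz r j) c ≡ exec x (decjz r j) c
      dj zero e' = trans (exec-dec0 y r j c e') (sym (exec-dec0 x r j c e'))
      dj (suc w) e' = trans (exec-decS y r j c w e') (sym (exec-decS x r j c w e'))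
    st (just (query r s)) e = trans (step-just y M c _ e) (trans (cong (λ v → record { pc = suc (pc c) ; reg = update (reg c) r v }) (ag _ (qb r s e))) (sym (step-just x M c _ e)))

  run-agree : ∀ x y M c s Q → (∀ i → i < s → QueryBelow M (run x M i c) Q) → (∀ p → p < Q → y p ≡ x p) →
              ∀ i → i ≤ s → run y M i c ≡ run x M i c
  run-agree x y M c s Q qb ag zero le = refl
  run-agree x y M c s Q qb ag (suc i) le =
    trans (cong (step y M) (run-agree x y M c s Q qb ag i (≤-trans (n≤1+n i) le))) (step-agree x y M _ Q (qb i le) ag)


-- Compilation of oracle terms into register machines, and the cost bound.
-- B is a monotone bound on the oracle values; it enters only the cost of orc.
module Compile (B : ℕ → ℕ) (Bmono : ∀ {a b} → a ≤ b → B a ≤ B b) where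

  open import Defs
  open Machine
  open MachineBlocks
  open import Data.Nat
  open import Data.Nat.Properties
  open import Data.Nat.Tactic.RingSolver
  open import Data.Fin using (Fin; zero; suc)
  open import Data.Vec using (Vec; []; _∷_; lookup)
  import Data.Vec as V
  open import Data.List using ([]; _∷_; _++_; length)
  open import Data.Maybe using (just)
  open import Data.Product using (_,_; proj₁; proj₂; _×_)
  open import Relation.Binary.PropositionalEquality
  open import Relation.Nullary using (yes; no)
  open import Data.Empty using (⊥-elim)
  open import Data.Sum using (_⊎_; inj₁; inj₂)
  open import Data.Bool using (true)
  open import Data.List.Properties using (length-++)

  -- Relocatable code: a block maps its start address to its instructions.
  Block : Set
  Block = ℕ → Program

  infixr 4 _⨾_
  _⨾_ : Block → Block → Block
  (b1 ⨾ b2) p = b1 p ++ b2 (p + length (b1 p))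

  seq-ex : ∀ {x M ρ ρ1 ρ2 T1 T2 Q} (b1 b2 : Block) p →
    (At M p (b1 p) → Exec x M p ρ (p + length (b1 p)) ρ1 T1 Q) →
    (At M (p + length (b1 p)) (b2 (p + length (b1 p))) →
       Exec x M (p + length (b1 p)) ρ1 (p + length (b1 p) + length (b2 (p + length (b1 p)))) ρ2 T2 Q) →
    At M p ((b1 ⨾ b2) p) → Exec x M p ρ (p + length ((b1 ⨾ b2) p)) ρ2 (T1 + T2) Q
  seq-ex {M = M} b1 b2 p E1 E2 a with at-++ M p (b1 p) (b2 (p + length (b1 p))) a
  ... | a1 , a2 = ex-pc refl (trans (+-assoc p _ _) (cong (p +_) (sym (length-++ (b1 p)))))
                    (ex-seq (E1 a1) (E2 a2))

  loopB : ℕ → Block → Block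
  loopB r body p = decjz r (p + suc (length (body (p + 1)) + 1)) ∷ (body (p + 1) ++ (decjz 1 p ∷ []))

  loop-ex : ∀ {x M Q} r (body : Block) tb (Sf : ℕ → ℕ → ℕ) p →
         (∀ n → Sf n r ≡ n) → (∀ n → Sf n 1 ≡ 0) → ∀ v →
         (∀ n → n < v → At M (p + 1) (body (p + 1)) →
            Exec x M (p + 1) (set (Sf (suc n)) r n) (p + 1 + length (body (p + 1))) (Sf n) tb Q) →
         At M p (loopB r body p) →
         Exec x M p (Sf v) (p + length (loopB r body p)) (Sf 0) (v * (tb + 2) + 1) Q
  loop-ex {x} {M} r body tb Sf p Sr Sz v bd (f , a) with at-++ M (suc p) (body (p + 1)) (decjz 1 p ∷ []) a
  ... | a1 , (f2 , _) =
    ex-pc refl (cong (λ z → p + suc z) (sym (length-++ (body (p + 1)))))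
     (loop r 1 lb tb _ Sf f (subst (λ q → fetch M q ≡ just (decjz 1 p)) (sym (+-suc p lb)) f2) Sr Sz v
       (λ n lt → ex-pc refl (trans (+-assoc p 1 lb) refl) (bd n lt (subst (λ q → At M q (body (p + 1))) (+-comm 1 p) a1))))
    where
    lb : ℕ
    lb = length (body (p + 1))

  incB : ℕ → Block
  incB r p = inc r ∷ []

  inc-ex : ∀ {x M ρ Q} r p → At M p (incB r p) → Exec x M p ρ (p + 1) (set ρ r (suc (ρ r))) 1 Q
  inc-ex r p (f , _) = ex-pc refl (+-comm 1 p) (i-inc r f)

  regs : ℕ → (m : ℕ) → Vec ℕ m
  regs y zero = []
  regs y (suc m) = y ∷ regs (suc y) m

  clearsB : ℕ → ℕ → Block
  clearsB y zero = λ _ → []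
  clearsB y (suc m) = clearC y ⨾ clearsB (suc y) m

  mutual
    -- compile p as out bs adds the value of p on the registers as to register out,
    -- using the registers from bs on as scratch.  Registers 0 and 1 are reserved (1 stays
    -- zero and serves for unconditional jumps).  Composition computes the arguments into
    -- bs …, applies g and clears them; recursion iterates the step in a counting loop.
    compile : ∀ {k} → Prim true k → Vec ℕ k → ℕ → ℕ → Block
    compile Z as out bs = λ _ → []
    compile S (a ∷ []) out bs = addcopyC a out bs ⨾ incB out
    compile (P i) as out bs = addcopyC (lookup as i) out bs
    compile orc (a ∷ []) out bs = λ p0 → query bs a ∷ transferC bs out (p0 + 1)
    compile (comp {m = m} g hs) as out bs = compileVec hs as bs (bs + m) ⨾ (compile g (regs bs m) out (bs + m) ⨾ clearsB bs m)
    compile (rec g h) (a ∷ as) out bs =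
      addcopyC a (bs + 2) (bs + 3) ⨾ (compile g as (bs + 1) (bs + 4) ⨾
      (loopB (bs + 2) (compile h (bs ∷ (bs + 1) ∷ as) (bs + 3) (bs + 4) ⨾ (clearC (bs + 1) ⨾ (transferC (bs + 3) (bs + 1) ⨾ incB bs))) ⨾
      (transferC (bs + 1) out ⨾ clearC bs)))

    compileVec : ∀ {k m} → Vec (Prim true k) m → Vec ℕ k → ℕ → ℕ → Block
    compileVec [] as y bs = λ _ → []
    compileVec (h ∷ hs) as y bs = compile h as y bs ⨾ compileVec hs as (suc y) bs

  -- The bound for the values of the recursion rec g h below j on arguments ≤ m,
  -- when the values of g and h are bounded by wg and wh.
  recCost : (ℕ → ℕ) → (ℕ → ℕ) → ℕ → ℕ → ℕ
  recCost wg wh m zero = wg m + m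
  recCost wg wh m (suc j) = wh (recCost wg wh m j + j) + recCost wg wh m j + j + 1

  mutual
    -- cost p m bounds the value of p, the running time of compile p and the positions
    -- of its oracle queries, when all arguments are at most m.
    cost : ∀ {k} → Prim true k → ℕ → ℕ
    cost Z m = m
    cost S m = 8 * m + 8
    cost (P i) m = 8 * m + 8
    cost orc m = 3 * B m + m + 2
    cost (comp {m = j} g hs) m = cost g (costVec hs m) + costVec hs m + j * (2 * costVec hs m + 1) + m
    cost (rec g h) m = cost g m + 10 * m + 10 + m * (6 * recCost (cost g) (cost h) m m + 5) + 3 * recCost (cost g) (cost h) m m

    costVec : ∀ {k m} → Vec (Prim true k) m → ℕ → ℕ
    costVec [] m = 0
    costVec (h ∷ hs) m = cost h m + costVec hs m

  Mono : (ℕ → ℕ) → Set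
  Mono f = ∀ {a b} → a ≤ b → f a ≤ f b

  module RecCost (wg wh : ℕ → ℕ) (mg : Mono wg) (mh : Mono wh) where
    A : ℕ → ℕ → ℕ
    A = recCost wg wh

    stepA : ∀ m j → A m j ≤ A m (suc j)
    stepA m j = ≤-trans (m≤n+m (A m j) (wh (A m j + j))) (≤-trans (m≤m+n _ j) (m≤m+n _ 1))

    monoj : ∀ m {j j'} → j ≤ j' → A m j ≤ A m j'
    monoj m {j} {j'} le with ≤⇒≤′ le
    ... | ≤′-refl = ≤-refl
    ... | ≤′-step le' = ≤-trans (monoj m (≤′⇒≤ le')) (stepA m _)

    ge-m : ∀ m j → m ≤ A m j
    ge-m m j = ≤-trans (m≤n+m m (wg m)) (monoj m {0} {j} z≤n)

    ge-wg : ∀ m j → wg m ≤ A m j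
    ge-wg m j = ≤-trans (m≤m+n (wg m) m) (monoj m {0} {j} z≤n)

    ge-wh : ∀ m j → wh (A m j + j) ≤ A m (suc j)
    ge-wh m j = ≤-trans (m≤m+n _ (A m j)) (≤-trans (m≤m+n _ j) (m≤m+n _ 1))

    monom : ∀ j {m m'} → m ≤ m' → A m j ≤ A m' j
    monom zero le = +-mono-≤ (mg le) le
    monom (suc j) le = +-mono-≤ (+-mono-≤ (+-mono-≤ (mh (+-mono-≤ (monom j le) ≤-refl)) (monom j le)) (≤-refl {j})) ≤-refl

    diag : Mono (λ m → A m m)
    diag {a} {b} le = ≤-trans (monom a le) (monoj b le)

  mutual
    cost-mono : ∀ {k} (p : Prim true k) → Mono (cost p)
    cost-mono Z le = le
    cost-mono S le = +-mono-≤ (*-monoʳ-≤ 8 le) ≤-refl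
    cost-mono (P i) le = +-mono-≤ (*-monoʳ-≤ 8 le) ≤-refl
    cost-mono orc le = +-mono-≤ (+-mono-≤ (*-monoʳ-≤ 3 (Bmono le)) le) ≤-refl
    cost-mono (comp {m = j} g hs) le =
      +-mono-≤ (+-mono-≤ (+-mono-≤ (cost-mono g (costVec-mono hs le)) (costVec-mono hs le)) (*-monoʳ-≤ j (+-mono-≤ (*-monoʳ-≤ 2 (costVec-mono hs le)) ≤-refl))) le
    cost-mono (rec g h) le =
      +-mono-≤ (+-mono-≤ (+-mono-≤ (+-mono-≤ (cost-mono g le) (*-monoʳ-≤ 10 le)) ≤-refl)
                         (*-mono-≤ le (+-mono-≤ (*-monoʳ-≤ 6 (RecCost.diag (cost g) (cost h) (cost-mono g) (cost-mono h) le)) ≤-refl)))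
               (*-monoʳ-≤ 3 (RecCost.diag (cost g) (cost h) (cost-mono g) (cost-mono h) le))

    costVec-mono : ∀ {k m} (hs : Vec (Prim true k) m) → Mono (costVec hs)
    costVec-mono [] le = z≤n
    costVec-mono (h ∷ hs) le = +-mono-≤ (cost-mono h le) (costVec-mono hs le)

  cost-≥ : ∀ {k} (p : Prim true k) m → m ≤ cost p m
  cost-≥ Z m = ≤-refl
  cost-≥ S m = ≤-trans (m≤n*m m 8) (m≤m+n _ 8)
  cost-≥ (P i) m = ≤-trans (m≤n*m m 8) (m≤m+n _ 8)
  cost-≥ orc m = ≤-trans (m≤n+m m (3 * B m)) (m≤m+n _ 2)
  cost-≥ (comp g hs) m = m≤n+m m _
  cost-≥ (rec g h) m = ≤-trans (≤-trans (m≤m*n m 10) (≤-reflexive (*-comm m 10))) (≤-trans (m≤n+m _ (cost g m)) (≤-trans (m≤m+n _ 10) (≤-trans (m≤m+n _ _) (m≤m+n _ _))))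

  module ValueBound (x : ℕ → ℕ) (xB : ∀ j → x j ≤ B j) where
    mutual
      value≤cost : ∀ {k} (p : Prim true k) m v → (∀ i → lookup v i ≤ m) → eval x p v ≤ cost p m
      value≤cost Z m v bd = z≤n
      value≤cost S m (a ∷ []) bd = ≤-trans (s≤s (bd zero)) (≤-trans (s≤s (m≤n*m m 8)) (≤-trans (≤-reflexive (+-comm 1 _)) (+-monoʳ-≤ (8 * m) (s≤s z≤n))))
      value≤cost (P i) m v bd = ≤-trans (bd i) (cost-≥ (P i) m)
      value≤cost orc m (a ∷ []) bd = ≤-trans (xB a) (≤-trans (Bmono (bd zero)) (≤-trans (m≤n*m (B m) 3) (≤-trans (m≤m+n _ m) (m≤m+n _ 2))))
      value≤cost (comp {m = j} g hs) m v bd =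
        ≤-trans (value≤cost g (costVec hs m) (evalVec x hs v) (values≤costVec hs m v bd))
          (≤-trans (m≤m+n _ _) (≤-trans (m≤m+n _ _) (m≤m+n _ _)))
      value≤cost (rec g h) m (n ∷ v) bd =
        ≤-trans (rec≤recCost g h m v (λ i → bd (suc i)) n)
          (≤-trans (RecCost.monoj (cost g) (cost h) (cost-mono g) (cost-mono h) m (bd zero))
            (≤-trans (m≤n*m _ 3) (m≤n+m _ (cost g m + 10 * m + 10 + m * (6 * recCost (cost g) (cost h) m m + 5)))))

      values≤costVec : ∀ {k j} (hs : Vec (Prim true k) j) m v → (∀ i → lookup v i ≤ m) → ∀ i → lookup (evalVec x hs v) i ≤ costVec hs m
      values≤costVec (h ∷ hs) m v bd zero = ≤-trans (value≤cost h m v bd) (m≤m+n _ _)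
      values≤costVec (h ∷ hs) m v bd (suc i) = ≤-trans (values≤costVec hs m v bd i) (m≤n+m _ _)

      rec≤recCost : ∀ {k} (g : Prim true k) h m v → (∀ i → lookup v i ≤ m) → ∀ j → eval x (rec g h) (j ∷ v) ≤ recCost (cost g) (cost h) m j
      rec≤recCost g h m v bd zero = ≤-trans (value≤cost g m v bd) (RecCost.ge-wg (cost g) (cost h) (cost-mono g) (cost-mono h) m 0)
      rec≤recCost g h m v bd (suc j) =
        ≤-trans (value≤cost h (recCost (cost g) (cost h) m j + j) (j ∷ eval x (rec g h) (j ∷ v) ∷ v) bd') (RecCost.ge-wh (cost g) (cost h) (cost-mono g) (cost-mono h) m j)
        where
        bd' : ∀ i → lookup (j ∷ eval x (rec g h) (j ∷ v) ∷ v) i ≤ recCost (cost g) (cost h) m j + j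
        bd' zero = m≤n+m j _
        bd' (suc zero) = ≤-trans (rec≤recCost g h m v bd j) (m≤m+n _ j)
        bd' (suc (suc i)) = ≤-trans (bd i) (≤-trans (RecCost.ge-m (cost g) (cost h) (cost-mono g) (cost-mono h) m j) (m≤m+n _ j))

  record Layout (ρ : ℕ → ℕ) {k} (as : Vec ℕ k) (out bs : ℕ) : Set where
    field
      z1 : ρ 1 ≡ 0
      scr : ∀ j → bs ≤ j → ρ j ≡ 0
      bs2 : 2 ≤ bs
      outlt : out < bs
      out1 : out ≢ 1
      arglt : ∀ i → lookup as i < bs
      argout : ∀ i → lookup as i ≢ out
      arg1 : ∀ i → lookup as i ≢ 1

  ≤-by : ∀ {a b c} → a ≡ b → b ≤ c → a ≤ c
  ≤-by refl le = le

  module Spec (x : ℕ → ℕ) (xB : ∀ j → x j ≤ B j) where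
    open ValueBound x xB

    Correct : ∀ {k} → Prim true k → Set
    Correct {k} p = ∀ M (as : Vec ℕ k) out bs ρ m p0 → Layout ρ as out bs → (∀ i → ρ (lookup as i) ≤ m) → At M p0 (compile p as out bs p0) →
      Exec x M p0 ρ (p0 + length (compile p as out bs p0)) (set ρ out (ρ out + eval x p (V.map ρ as))) (cost p m) (cost p m)

    correct-Z : ∀ {k} → Correct (Z {true} {k})
    correct-Z M as out bs ρ m p0 G bd at = ex-pc refl (sym (+-identityʳ p0)) (ex-refl pw)
      where
      pw : ∀ k → ρ k ≡ set ρ out (ρ out + 0) k
      pw k = trans (set-self ρ out k) (set-cong out (λ _ → refl) (sym (+-identityʳ (ρ out))) k)

    correct-S : Correct S
    correct-S M (a ∷ []) out bs ρ m p0 G bd at =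
      ex-mono tle z≤n
       (ex-post pw
        (seq-ex (addcopyC a out bs) (incB out) p0
          (λ at1 → addcopy-ex a out bs at1 (Layout.z1 G) (Layout.scr G bs ≤-refl) (Layout.argout G zero) (<⇒≢ (Layout.arglt G zero))
                    (<⇒≢ (Layout.outlt G)) (Layout.arg1 G zero) (Layout.out1 G) (λ e → <-irrefl (sym e) (Layout.bs2 G)))
          (λ at2 → inc-ex out _ at2) at))
      where
      pw : ∀ k → set (set ρ out (ρ out + ρ a)) out (suc (set ρ out (ρ out + ρ a) out)) k ≡ set ρ out (ρ out + suc (ρ a)) k
      pw k = trans (set-set ρ out _ _ k) (set-cong out (λ _ → refl) (trans (cong suc U=) (sym (+-suc (ρ out) (ρ a)))) k)
      tle : ρ a * 4 + 1 + (ρ a * 3 + 1) + 1 ≤ 8 * m + 8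
      tle = ≤-by (lem (ρ a)) (+-mono-≤ (≤-trans (*-monoʳ-≤ 7 (bd zero)) (*-monoˡ-≤ m (n≤1+n 7))) (s≤s (s≤s (s≤s z≤n))))
        where
        lem : ∀ v → v * 4 + 1 + (v * 3 + 1) + 1 ≡ 7 * v + 3
        lem = solve-∀

    correct-P : ∀ {k} (i : Fin k) → Correct (P {true} i)
    correct-P i M as out bs ρ m p0 G bd at =
      ex-mono tle z≤n
       (ex-post pw
         (addcopy-ex (lookup as i) out bs at (Layout.z1 G) (Layout.scr G bs ≤-refl) (Layout.argout G i) (<⇒≢ (Layout.arglt G i))
                    (<⇒≢ (Layout.outlt G)) (Layout.arg1 G i) (Layout.out1 G) (λ e → <-irrefl (sym e) (Layout.bs2 G))))
      where
      pw : ∀ k → set ρ out (ρ out + ρ (lookup as i)) k ≡ set ρ out (ρ out + lookup (V.map ρ as) i) k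
      pw k = set-cong out (λ _ → refl) (cong (ρ out +_) (sym (VP.lookup-map i ρ as))) k
        where import Data.Vec.Properties as VP
      v : ℕ
      v = ρ (lookup as i)
      tle : v * 4 + 1 + (v * 3 + 1) ≤ 8 * m + 8
      tle = ≤-by (lem v) (+-mono-≤ (≤-trans (*-monoʳ-≤ 7 (bd i)) (*-monoˡ-≤ m (n≤1+n 7))) (s≤s (s≤s z≤n)))
        where
        lem : ∀ v → v * 4 + 1 + (v * 3 + 1) ≡ 7 * v + 2
        lem = solve-∀

    correct-orc : Correct orc
    correct-orc M (a ∷ []) out bs ρ m p0 G bd (f , at) =
      ex-mono tle ≤-refl
       (ex-pc refl (+-assoc p0 1 3)
        (ex-post pw
         (ex-seq (ex-pc refl (+-comm 1 p0) (i-query bs a f qlt))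
           (transfer-ex bs out (subst (λ q → At M q (transferC bs out (p0 + 1))) (+-comm 1 p0) at)
             (trans (U≠ (λ e → <-irrefl e (Layout.bs2 G))) (Layout.z1 G)) (λ e → <⇒≢ (Layout.outlt G) (sym e))
             (λ e → <-irrefl (sym e) (Layout.bs2 G)) (Layout.out1 G)))))
      where
      σ : ℕ → ℕ
      σ = set ρ bs (x (ρ a))
      qlt : ρ a < cost orc m
      qlt = ≤-trans (s≤s (≤-trans (bd zero) (m≤n+m m (3 * B m)))) (≤-trans (≤-reflexive (+-comm 1 (3 * B m + m))) (+-monoʳ-≤ (3 * B m + m) (s≤s z≤n)))
      pw : ∀ k → set (set σ bs 0) out (σ out + σ bs) k ≡ set ρ out (ρ out + x (ρ a)) k
      pw k with k ≟ out
      ... | yes refl = trans U= (trans (cong₂ _+_ (U≠ (<⇒≢ (Layout.outlt G))) U=) (sym U=))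
      ... | no ne with k ≟ bs
      ...   | yes refl = trans (U≠ ne) (trans U= (trans (sym (Layout.scr G bs ≤-refl)) (sym (U≠ ne))))
      ...   | no ne' = trans (U≠ ne) (trans (U≠ ne') (trans (U≠ ne') (sym (U≠ ne))))
      tle : 1 + (σ bs * 3 + 1) ≤ 3 * B m + m + 2
      tle = ≤-by (cong (λ w → 1 + (w * 3 + 1)) U=)
             (≤-by (lem (x (ρ a))) (≤-trans (+-mono-≤ (*-monoʳ-≤ 3 (≤-trans (xB (ρ a)) (Bmono (bd zero)))) (≤-refl {2}))
                                     (+-mono-≤ (m≤m+n _ m) (≤-refl {2}))))
        where
        lem : ∀ w → 1 + (w * 3 + 1) ≡ 3 * w + 2
        lem = solve-∀

  setV : ∀ {j} → (ℕ → ℕ) → ℕ → Vec ℕ j → ℕ → ℕ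
  setV ρ y [] = ρ
  setV ρ y (w ∷ ws) = setV (set ρ y w) (suc y) ws

  zeroV : (ℕ → ℕ) → ℕ → ℕ → ℕ → ℕ
  zeroV σ y zero = σ
  zeroV σ y (suc j) = zeroV (set σ y 0) (suc y) j

  Out : ℕ → ℕ → ℕ → Set
  Out y j k = k < y ⊎ y + j ≤ k

  out-suc : ∀ {y j k} → Out y (suc j) k → Out (suc y) j k × k ≢ y
  out-suc {y} {j} {k} (inj₁ lt) = inj₁ (≤-trans lt (n≤1+n y)) , <⇒≢ lt
  out-suc {y} {j} {k} (inj₂ le) = inj₂ (≤-trans (≤-reflexive (sym (+-suc y j))) le) ,
    (λ e → <-irrefl (sym e) (≤-trans (≤-trans (s≤s (m≤m+n y j)) (≤-reflexive (sym (+-suc y j)))) le))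

  setV-out : ∀ {j} ρ y (ws : Vec ℕ j) k → Out y j k → setV ρ y ws k ≡ ρ k
  setV-out ρ y [] k o = refl
  setV-out ρ y (w ∷ ws) k o = trans (setV-out (set ρ y w) (suc y) ws k (proj₁ (out-suc o))) (U≠ (proj₂ (out-suc o)))

  zeroV-out : ∀ σ y j k → Out y j k → zeroV σ y j k ≡ σ k
  zeroV-out σ y zero k o = refl
  zeroV-out σ y (suc j) k o = trans (zeroV-out (set σ y 0) (suc y) j k (proj₁ (out-suc o))) (U≠ (proj₂ (out-suc o)))

  zeroV-in : ∀ σ y j k → y ≤ k → k < y + j → zeroV σ y j k ≡ 0
  zeroV-in σ y zero k le lt = ⊥-elim (<-irrefl refl (≤-trans lt (≤-trans (≤-reflexive (+-identityʳ y)) le)))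
  zeroV-in σ y (suc j) k le lt with k ≟ y
  ... | yes refl = trans (zeroV-out (set σ k 0) (suc k) j k (inj₁ ≤-refl)) U=
  ... | no ne = zeroV-in (set σ y 0) (suc y) j k (≤∧≢⇒< le (λ e → ne (sym e))) (≤-trans lt (≤-reflexive (+-suc y j)))

  regs-map : ∀ {j} ρ y (ws : Vec ℕ j) → V.map (setV ρ y ws) (regs y j) ≡ ws
  regs-map ρ y [] = refl
  regs-map ρ y (w ∷ ws) = cong₂ _∷_ (trans (setV-out (set ρ y w) (suc y) ws y (inj₁ ≤-refl)) U=) (regs-map (set ρ y w) (suc y) ws)

  regs-lookup : ∀ y j (i : Fin j) → y ≤ lookup (regs y j) i × lookup (regs y j) i < y + j
  regs-lookup y (suc j) zero = ≤-refl , ≤-trans (s≤s (m≤m+n y j)) (≤-reflexive (sym (+-suc y j)))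
  regs-lookup y (suc j) (suc i) with regs-lookup (suc y) j i
  ... | a , b = ≤-trans (n≤1+n y) a , ≤-trans b (≤-reflexive (sym (+-suc y j)))

  vm-ext : ∀ {k} (f g : ℕ → ℕ) (as : Vec ℕ k) → (∀ i → f (lookup as i) ≡ g (lookup as i)) → V.map f as ≡ V.map g as
  vm-ext f g [] e = refl
  vm-ext f g (a ∷ as) e = cong₂ _∷_ (e zero) (vm-ext f g as (λ i → e (suc i)))

  clears-ex : ∀ {x M Q} y j p σ Vb → σ 1 ≡ 0 → 2 ≤ y → (∀ i → i < j → σ (y + i) ≤ Vb) → At M p (clearsB y j p) →
              Exec x M p σ (p + length (clearsB y j p)) (zeroV σ y j) (j * (Vb * 2 + 1)) Q
  clears-ex y zero p σ Vb z y2 bd at = ex-pc refl (sym (+-identityʳ p)) (ex-refl (λ _ → refl))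
  clears-ex {M = M} y (suc j) p σ Vb z y2 bd at =
    ex-mono (+-monoˡ-≤ (j * (Vb * 2 + 1)) (+-monoˡ-≤ 1 (*-monoˡ-≤ 2 (≤-trans (≤-reflexive (cong σ (sym (+-identityʳ y)))) (bd 0 (s≤s z≤n)))))) ≤-refl
     (seq-ex (clearC y) (clearsB (suc y) j) p
       (λ at1 → clear-ex y at1 z (λ e → <-irrefl (sym e) y2))
       (λ at2 → clears-ex (suc y) j _ (set σ y 0) Vb (trans (U≠ (λ e → <-irrefl e y2)) z) (≤-trans y2 (n≤1+n y))
                  (λ i lt → ≤-trans (≤-reflexive (trans (U≠ (λ e → <-irrefl (sym e) (≤-trans (s≤s (m≤m+n y i)) (≤-reflexive (cong suc refl))))) (cong σ (sym (+-suc y i))))) (bd (suc i) (s≤s lt))) at2)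
       at)

  module SpecComp (x : ℕ → ℕ) (xB : ∀ j → x j ≤ B j) where
    open ValueBound x xB
    open Spec x xB

    CorrectVec : ∀ {k j} → Vec (Prim true k) j → Set
    CorrectVec {k} {j} hs = ∀ M (as : Vec ℕ k) y bs' ρ m p0 → ρ 1 ≡ 0 → (∀ i → y ≤ i → ρ i ≡ 0) → 2 ≤ y → y + j ≤ bs' →
      (∀ i → lookup as i < y) → (∀ i → lookup as i ≢ 1) → (∀ i → ρ (lookup as i) ≤ m) → At M p0 (compileVec hs as y bs' p0) →
      Exec x M p0 ρ (p0 + length (compileVec hs as y bs' p0)) (setV ρ y (evalVec x hs (V.map ρ as))) (costVec hs m) (costVec hs m)

    correct-[] : ∀ {k} → CorrectVec {k} []
    correct-[] M as y bs' ρ m p0 z scr y2 yb alt a1 bd at = ex-pc refl (sym (+-identityʳ p0)) (ex-refl (λ _ → refl))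

    correct-∷ : ∀ {k j} (h : Prim true k) (hs : Vec (Prim true k) j) → Correct h → CorrectVec hs → CorrectVec (h ∷ hs)
    correct-∷ {j = j} h hs sh shs M as y bs' ρ m p0 z scr y2 yb alt a1 bd at =
      ex-mono ≤-refl (≤-refl {costVec (h ∷ hs) m})
       (seq-ex (compile h as y bs') (compileVec hs as (suc y) bs') p0
         (λ at1 → ex-mono ≤-refl (m≤m+n (cost h m) (costVec hs m)) (ex-post pw1 (sh M as y bs' ρ m p0 G bd at1)))
         (λ at2 → ex-mono ≤-refl (m≤n+m (costVec hs m) (cost h m))
                    (ex-post pw2 (shs M as (suc y) bs' ρ1 m _
                       (trans (U≠ (λ e → <-irrefl e y2)) z)
                       (λ i le → trans (U≠ (λ e → <-irrefl (sym e) le)) (scr i (≤-trans (n≤1+n y) le)))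
                       (≤-trans y2 (n≤1+n y)) (≤-trans (≤-reflexive (sym (+-suc y j))) yb)
                       (λ i → ≤-trans (alt i) (n≤1+n y)) a1
                       (λ i → ≤-trans (≤-reflexive (U≠ (<⇒≢ (alt i)))) (bd i)) at2)))
         at)
      where
      e : ℕ
      e = eval x h (V.map ρ as)
      ρ1 : ℕ → ℕ
      ρ1 = set ρ y e
      y<bs' : y < bs'
      y<bs' = ≤-trans (≤-trans (s≤s (m≤m+n y j)) (≤-reflexive (sym (+-suc y j)))) yb
      G : Layout ρ as y bs'
      G = record { z1 = z ; scr = λ i le → scr i (≤-trans (<⇒≤ y<bs') le) ; bs2 = ≤-trans y2 (<⇒≤ y<bs') ; outlt = y<bs'
                 ; out1 = λ e → <-irrefl (sym e) y2 ; arglt = λ i → <-trans (alt i) y<bs' ; argout = λ i → <⇒≢ (alt i) ; arg1 = a1 }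
      pw1 : ∀ k → set ρ y (ρ y + e) k ≡ ρ1 k
      pw1 k = set-cong y (λ _ → refl) (cong (_+ e) (scr y ≤-refl)) k
      pw2 : ∀ k → setV ρ1 (suc y) (evalVec x hs (V.map ρ1 as)) k ≡ setV ρ1 (suc y) (evalVec x hs (V.map ρ as)) k
      pw2 k = cong (λ w → setV ρ1 (suc y) (evalVec x hs w) k) (vm-ext ρ1 ρ as (λ i → U≠ (<⇒≢ (alt i))))

    setV-bound : ∀ {j} ρ y (ws : Vec ℕ j) Vb → (∀ f → lookup ws f ≤ Vb) → ∀ i → i < j → setV ρ y ws (y + i) ≤ Vb
    setV-bound ρ y (w ∷ ws) Vb bd zero lt = ≤-trans (≤-reflexive (trans (cong (setV (set ρ y w) (suc y) ws) (+-identityʳ y))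
                                            (trans (setV-out (set ρ y w) (suc y) ws y (inj₁ ≤-refl)) U=))) (bd zero)
    setV-bound ρ y (w ∷ ws) Vb bd (suc i) (s≤s lt) = ≤-trans (≤-reflexive (cong (setV (set ρ y w) (suc y) ws) (+-suc y i)))
                                            (setV-bound (set ρ y w) (suc y) ws Vb (λ f → bd (suc f)) i lt)

    correct-comp : ∀ {k j} (g : Prim true j) (hs : Vec (Prim true k) j) → Correct g → CorrectVec hs → Correct (comp g hs)
    correct-comp {k} {j} g hs sg shs M as out bs ρ m p0 G bd at =
      ex-mono tle ≤-refl (ex-post pw
       (seq-ex (compileVec hs as bs (bs + j)) (compile g (regs bs j) out (bs + j) ⨾ clearsB bs j) p0
         (λ at1 → ex-mono ≤-refl Q1 (shs M as bs (bs + j) ρ m p0 (Layout.z1 G) (Layout.scr G) (Layout.bs2 G) ≤-refl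
                            (Layout.arglt G) (Layout.arg1 G) bd at1))
         (λ at23 → seq-ex (compile g (regs bs j) out (bs + j)) (clearsB bs j) _
            (λ at2 → ex-mono ≤-refl Q2 (sg M (regs bs j) out (bs + j) ρ1 (costVec hs m) _ G1 bd1 at2))
            (λ at3 → clears-ex bs j _ ρ2 (costVec hs m) (trans (U≠ (λ e → Layout.out1 G (sym e))) (Layout.z1 G1)) (Layout.bs2 G)
                       (λ i lt → ≤-trans (≤-reflexive (U≠ (λ e → <-irrefl (sym e) (≤-trans (Layout.outlt G) (m≤m+n bs i)))))
                                    (setV-bound ρ bs vals (costVec hs m) (values≤costVec hs m (V.map ρ as) bdm) i lt)) at3)
            at23)
         at))
      where
      -- Three phases: the arguments hs are computed into bs, …, bs + j - 1 (ρ1),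
      -- g is applied to these registers (ρ2), and they are cleared again.
      import Data.Vec.Properties as VP
      vals : Vec ℕ j
      vals = evalVec x hs (V.map ρ as)
      ρ1 : ℕ → ℕ
      ρ1 = setV ρ bs vals
      e : ℕ
      e = eval x g (V.map ρ1 (regs bs j))
      ρ2 : ℕ → ℕ
      ρ2 = set ρ1 out (ρ1 out + e)
      Wc : ℕ
      Wc = cost (comp g hs) m
      bdm : ∀ i → lookup (V.map ρ as) i ≤ m
      bdm i = ≤-trans (≤-reflexive (VP.lookup-map i ρ as)) (bd i)
      Q1 : costVec hs m ≤ Wc
      Q1 = ≤-trans (m≤n+m _ (cost g (costVec hs m))) (≤-trans (m≤m+n _ _) (m≤m+n _ m))
      Q2 : cost g (costVec hs m) ≤ Wc
      Q2 = ≤-trans (m≤m+n _ (costVec hs m)) (≤-trans (m≤m+n _ _) (m≤m+n _ m))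
      tle : costVec hs m + (cost g (costVec hs m) + j * (costVec hs m * 2 + 1)) ≤ Wc
      tle = ≤-by (lem (costVec hs m) (cost g (costVec hs m)) j) (m≤m+n _ m)
        where
        lem : ∀ a b j → a + (b + j * (a * 2 + 1)) ≡ b + a + j * (2 * a + 1)
        lem = solve-∀
      out<bs+j : out < bs + j
      out<bs+j = ≤-trans (Layout.outlt G) (m≤m+n bs j)
      G1 : Layout ρ1 (regs bs j) out (bs + j)
      G1 = record { z1 = trans (setV-out ρ bs vals 1 (inj₁ (Layout.bs2 G))) (Layout.z1 G)
                  ; scr = λ i le → trans (setV-out ρ bs vals i (inj₂ le)) (Layout.scr G i (≤-trans (m≤m+n bs j) le))
                  ; bs2 = ≤-trans (Layout.bs2 G) (m≤m+n bs j)
                  ; outlt = out<bs+j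
                  ; out1 = Layout.out1 G
                  ; arglt = λ i → proj₂ (regs-lookup bs j i)
                  ; argout = λ i e → <-irrefl (sym e) (≤-trans (Layout.outlt G) (proj₁ (regs-lookup bs j i)))
                  ; arg1 = λ i e → <-irrefl (sym e) (≤-trans (Layout.bs2 G) (proj₁ (regs-lookup bs j i))) }
      rm : V.map ρ1 (regs bs j) ≡ vals
      rm = regs-map ρ bs vals
      bd1 : ∀ i → ρ1 (lookup (regs bs j) i) ≤ costVec hs m
      bd1 i = ≤-trans (≤-reflexive (trans (sym (VP.lookup-map i ρ1 (regs bs j))) (cong (λ w → lookup w i) rm)))
                      (values≤costVec hs m (V.map ρ as) bdm i)
      -- After clearing, only out differs from ρ: below bs by the two updates, in the
      -- argument range by clearing, and above it by the scratch invariant.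
      pw : ∀ k → zeroV ρ2 bs j k ≡ set ρ out (ρ out + eval x g vals) k
      pw k with k <? bs
      ... | yes k<bs = trans (zeroV-out ρ2 bs j k (inj₁ k<bs)) pw'
        where
        pw' : ρ2 k ≡ set ρ out (ρ out + eval x g vals) k
        pw' with k ≟ out
        ... | yes refl = trans U= (trans (cong₂ _+_ (setV-out ρ bs vals k (inj₁ k<bs)) (cong (eval x g) rm)) (sym U=))
        ... | no ne = trans (U≠ ne) (trans (setV-out ρ bs vals k (inj₁ k<bs)) (sym (U≠ ne)))
      ... | no k≮bs with k <? bs + j
      ...   | yes lt = trans (zeroV-in ρ2 bs j k (≮⇒≥ k≮bs) lt)
                        (sym (trans (U≠ (λ e → k≮bs (subst (_< bs) (sym e) (Layout.outlt G)))) (Layout.scr G k (≮⇒≥ k≮bs))))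
      ...   | no ge = trans (zeroV-out ρ2 bs j k (inj₂ (≮⇒≥ ge)))
                       (trans (U≠ ne) (trans (setV-out ρ bs vals k (inj₂ (≮⇒≥ ge))) (sym (U≠ ne))))
        where
        ne : k ≢ out
        ne e = k≮bs (subst (_< bs) (sym e) (Layout.outlt G))

module CompileRec (B : ℕ → ℕ) (Bmono : ∀ {a b} → a ≤ b → B a ≤ B b) where

  open import Defs
  open Machine
  open MachineBlocks
  open NatFacts
  open Compile B Bmono
  open import Data.Nat
  open import Data.Nat.Properties
  open import Data.Nat.Tactic.RingSolver
  open import Data.Fin using (zero; suc)
  open import Data.Vec using (Vec; []; _∷_; lookup)
  import Data.Vec as V
  open import Data.List using ([]; _∷_; length)
  open import Data.Maybe using (nothing)
  open import Relation.Binary.PropositionalEquality hiding (J)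
  open import Relation.Nullary using (yes; no)
  open import Data.Bool using (true)

  +-≢ : ∀ b {i j} → i ≢ j → b + i ≢ b + j
  +-≢ b ne e = ne (+-cancelˡ-≡ b _ _ e)

  ≢+suc : ∀ b i → b ≢ b + suc i
  ≢+suc b i e = <-irrefl e (≤-trans (s≤s (m≤m+n b i)) (≤-reflexive (sym (+-suc b i))))

  <⇒≢+ : ∀ {a b} i → a < b → a ≢ b + i
  <⇒≢+ {a} {b} i lt e = <-irrefl e (≤-trans lt (m≤m+n b i))

  module RecPhases (x : ℕ → ℕ) (xB : ∀ j → x j ≤ B j) {k : ℕ}
    (g : Prim true k) (h : Prim true (suc (suc k))) (sg : Spec.Correct x xB g) (sh : Spec.Correct x xB h)
    (M : Program) (a : ℕ) (as : Vec ℕ k) (out bs : ℕ) (ρ : ℕ → ℕ) (m p0 : ℕ)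
    (G : Layout ρ (a ∷ as) out bs) (bd : ∀ i → ρ (lookup (a ∷ as) i) ≤ m) where
    open ValueBound x xB
    open Spec x xB

    import Data.Vec.Properties as VP
    module AL = RecCost (cost g) (cost h) (cost-mono g) (cost-mono h)

    -- Scratch registers: the counter J, the accumulator Ar, the loop register R,
    -- a temporary Tm, and the scratch area bs + 4 … of the subcomputations.
    J Ar R Tm bs4 : ℕ
    J = bs
    Ar = bs + 1
    R = bs + 2
    Tm = bs + 3
    bs4 = bs + 4

    Wr A tb : ℕ
    Wr = cost (rec g h) m
    A = recCost (cost g) (cost h) m m
    tb = 6 * A + 3

    -- The five phases of the compiled code: set up the loop register, compute the
    -- base case into Ar, iterate the step n0 times, move Ar to out, clear J.
    bodyB b1 b2 b3 b4 b5 : Block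
    bodyB = compile h (bs ∷ (bs + 1) ∷ as) (bs + 3) (bs + 4) ⨾ (clearC (bs + 1) ⨾ (transferC (bs + 3) (bs + 1) ⨾ incB bs))
    b1 = addcopyC a R Tm
    b2 = compile g as Ar bs4
    b3 = loopB R bodyB
    b4 = transferC Ar out
    b5 = clearC J

    vals : Vec ℕ k
    vals = V.map ρ as

    n0 : ℕ
    n0 = ρ a

    aa : ℕ → ℕ
    aa j = eval x (rec g h) (j ∷ vals)
    bs2 : 2 ≤ bs
    bs2 = Layout.bs2 G

    1≢J : 1 ≢ J
    1≢J e = <-irrefl e bs2
    1≢b : ∀ i → 1 ≢ bs + i
    1≢b i = <⇒≢+ i bs2
    oJ : out ≢ J
    oJ = <⇒≢ (Layout.outlt G)
    ob : ∀ i → out ≢ bs + i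
    ob i = <⇒≢+ i (Layout.outlt G)
    aJ : ∀ i → lookup as i ≢ J
    aJ i = <⇒≢ (Layout.arglt G (suc i))
    ab : ∀ i j → lookup as i ≢ bs + j
    ab i j = <⇒≢+ j (Layout.arglt G (suc i))
    a0b : ∀ j → a ≢ bs + j
    a0b j = <⇒≢+ j (Layout.arglt G zero)
    J≢b : ∀ i → J ≢ bs + suc i
    J≢b i = ≢+suc bs i
    gt : ∀ {i} c → c < 4 → bs4 ≤ i → i ≢ bs + c
    gt c lt le e = <-irrefl (sym e) (≤-trans (+-monoʳ-< bs lt) le)
    gtJ : ∀ {i} → bs4 ≤ i → i ≢ J
    gtJ le e = <-irrefl (sym e) (≤-trans (≤-trans (s≤s (m≤m+n bs 3)) (≤-reflexive (sym (+-suc bs 3)))) le)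
    J<4 : J < bs4
    J<4 = ≤-trans (s≤s (m≤m+n bs 3)) (≤-reflexive (sym (+-suc bs 3)))
    -- Register contents between the phases; Sf n is the loop invariant with n
    -- iterations still to go: J = n0 ∸ n and Ar = aa (n0 ∸ n).
    ρ1 ρ2 : ℕ → ℕ
    ρ1 = set ρ R n0
    ρ2 = set ρ1 Ar (ρ1 Ar + eval x g (V.map ρ1 as))

    Sf : ℕ → ℕ → ℕ
    Sf n = set (set (set ρ1 J (n0 ∸ n)) Ar (aa (n0 ∸ n))) R n

    S0 ρ4 : ℕ → ℕ
    S0 = Sf 0
    ρ4 = set (set S0 Ar 0) out (S0 out + S0 Ar)
    vals1 : V.map ρ1 as ≡ vals
    vals1 = vm-ext ρ1 ρ as (λ i → U≠ (ab i 2))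
    scrρ : ∀ i → ρ (bs + i) ≡ 0
    scrρ i = Layout.scr G (bs + i) (m≤m+n bs i)
    scrJ : ρ J ≡ 0
    scrJ = Layout.scr G bs ≤-refl
    ρ1z : ρ1 1 ≡ 0
    ρ1z = trans (U≠ (1≢b 2)) (Layout.z1 G)
    E1 : At M p0 (b1 p0) → Exec x M p0 ρ (p0 + length (b1 p0)) ρ1 (n0 * 4 + 1 + (n0 * 3 + 1)) Wr
    E1 at1 = ex-post (λ k → set-cong R (λ _ → refl) (cong (_+ n0) (scrρ 2)) k)
               (addcopy-ex a R Tm at1 (Layout.z1 G) (scrρ 3) (a0b 2) (a0b 3) (+-≢ bs (λ ())) (Layout.arg1 G zero)
                 (≢-sym (1≢b 2)) (≢-sym (1≢b 3)))
    G2 : Layout ρ1 as Ar bs4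
    G2 = record { z1 = ρ1z
                ; scr = λ i le → trans (U≠ (gt 2 (s≤s (s≤s (s≤s z≤n))) le)) (Layout.scr G i (≤-trans (m≤m+n bs 4) le))
                ; bs2 = ≤-trans bs2 (m≤m+n bs 4)
                ; outlt = +-monoʳ-< bs (s≤s (s≤s z≤n))
                ; out1 = ≢-sym (1≢b 1)
                ; arglt = λ i → ≤-trans (Layout.arglt G (suc i)) (m≤m+n bs 4)
                ; argout = λ i → ab i 1
                ; arg1 = λ i → Layout.arg1 G (suc i) }
    Q2 : cost g m ≤ Wr
    Q2 = ≤-trans (m≤m+n (cost g m) (10 * m)) (≤-trans (m≤m+n _ 10) (≤-trans (m≤m+n _ _) (m≤m+n _ _)))
    E2 : ∀ {q} → At M q (b2 q) → Exec x M q ρ1 (q + length (b2 q)) ρ2 (cost g m) Wr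
    E2 at2 = ex-mono ≤-refl Q2 (sg M as Ar bs4 ρ1 m _ G2 (λ i → ≤-trans (≤-reflexive (U≠ (ab i 2))) (bd (suc i))) at2)
    QA : A ≤ Wr
    QA = ≤-trans (m≤n*m A 3) (m≤n+m _ (cost g m + 10 * m + 10 + m * (6 * A + 5)))

    -- One loop iteration, with n further iterations to come: the step h is computed
    -- from (J, Ar, vals) into Tm, which then replaces Ar, and J is incremented.
    module Iteration (n : ℕ) (lt : n < n0) where
      bh bcl btr binc : Block
      bh = compile h (bs ∷ (bs + 1) ∷ as) (bs + 3) (bs + 4)
      bcl = clearC (bs + 1)
      btr = transferC (bs + 3) (bs + 1)
      binc = incB bs
      j : ℕ
      j = n0 ∸ suc n
      σ0 σ1 σ2 σ3 : ℕ → ℕ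
      σ0 = set (Sf (suc n)) R n
      σ1 = set σ0 Tm (σ0 Tm + eval x h (V.map σ0 (J ∷ Ar ∷ as)))
      σ2 = set σ1 Ar 0
      σ3 = set (set σ2 Tm 0) Ar (σ2 Ar + σ2 Tm)
      mh : ℕ
      mh = recCost (cost g) (cost h) m j + j
      σ0J : σ0 J ≡ j
      σ0J = trans (U≠ (J≢b 1)) (trans (U≠ (J≢b 1)) (trans (U≠ (J≢b 0)) U=))
      σ0A : σ0 Ar ≡ aa j
      σ0A = trans (U≠ (+-≢ bs (λ ()))) (trans (U≠ (+-≢ bs (λ ()))) U=)
      σ0T : σ0 Tm ≡ 0
      σ0T = trans (U≠ (+-≢ bs (λ ()))) (trans (U≠ (+-≢ bs (λ ()))) (trans (U≠ (+-≢ bs (λ ()))) (trans (U≠ (≢-sym (J≢b 2))) (trans (U≠ (+-≢ bs (λ ()))) (scrρ 3)))))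
      σ0as : ∀ i → σ0 (lookup as i) ≡ ρ (lookup as i)
      σ0as i = trans (U≠ (ab i 2)) (trans (U≠ (ab i 2)) (trans (U≠ (ab i 1)) (trans (U≠ (aJ i)) (U≠ (ab i 2)))))
      σ0z : σ0 1 ≡ 0
      σ0z = trans (U≠ (1≢b 2)) (trans (U≠ (1≢b 2)) (trans (U≠ (1≢b 1)) (trans (U≠ 1≢J) ρ1z)))
      jle : suc j ≤ m
      jle = ≤-trans (≤-trans (≤-reflexive (sub-suc n0 n lt)) (m∸n≤m n0 n)) (bd zero)
      Gh : Layout σ0 (J ∷ Ar ∷ as) Tm bs4
      Gh = record { z1 = σ0z
                  ; scr = λ i le → trans (U≠ (gt 2 (s≤s (s≤s (s≤s z≤n))) le)) (trans (U≠ (gt 2 (s≤s (s≤s (s≤s z≤n))) le))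
                                   (trans (U≠ (gt 1 (s≤s (s≤s z≤n)) le)) (trans (U≠ (gtJ le)) (trans (U≠ (gt 2 (s≤s (s≤s (s≤s z≤n))) le))
                                   (Layout.scr G i (≤-trans (m≤m+n bs 4) le))))))
                  ; bs2 = ≤-trans bs2 (m≤m+n bs 4)
                  ; outlt = +-monoʳ-< bs (≤-refl {4})
                  ; out1 = ≢-sym (1≢b 3)
                  ; arglt = λ { zero → J<4
                              ; (suc zero) → +-monoʳ-< bs (s≤s (s≤s z≤n))
                              ; (suc (suc i)) → ≤-trans (Layout.arglt G (suc i)) (m≤m+n bs 4) }
                  ; argout = λ { zero → J≢b 2 ; (suc zero) → +-≢ bs (λ ()) ; (suc (suc i)) → ab i 3 }
                  ; arg1 = λ { zero → ≢-sym 1≢J ; (suc zero) → ≢-sym (1≢b 1) ; (suc (suc i)) → Layout.arg1 G (suc i) } }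
      bdh : ∀ i → σ0 (lookup (J ∷ Ar ∷ as) i) ≤ mh
      bdh zero = ≤-trans (≤-reflexive σ0J) (m≤n+m j _)
      bdh (suc zero) = ≤-trans (≤-reflexive σ0A) (≤-trans (rec≤recCost g h m vals (λ i → ≤-trans (≤-reflexive (VP.lookup-map i ρ as)) (bd (suc i))) j) (m≤m+n _ j))
      bdh (suc (suc i)) = ≤-trans (≤-reflexive (σ0as i)) (≤-trans (bd (suc i)) (≤-trans (AL.ge-m m j) (m≤m+n _ j)))
      hv : V.map σ0 (J ∷ Ar ∷ as) ≡ j ∷ aa j ∷ vals
      hv = cong₂ _∷_ σ0J (cong₂ _∷_ σ0A (vm-ext σ0 ρ as σ0as))
      WhA : cost h mh ≤ A
      WhA = ≤-trans (AL.ge-wh m j) (AL.monoj m jle)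
      Eh : ∀ {q} → At M q (bh q) → Exec x M q σ0 (q + length (bh q)) (set σ0 Tm (σ0 Tm + eval x h (V.map σ0 (J ∷ Ar ∷ as)))) (cost h mh) Wr
      Eh ath = ex-mono ≤-refl (≤-trans WhA QA) (sh M (J ∷ Ar ∷ as) Tm bs4 σ0 mh _ Gh bdh ath)
      σ1z : σ1 1 ≡ 0
      σ1z = trans (U≠ (1≢b 3)) σ0z
      Ecl : ∀ {q'} → At M q' (bcl q') → Exec x M q' σ1 (q' + 2) (set σ1 Ar 0) (σ1 Ar * 2 + 1) Wr
      Ecl atc = clear-ex Ar atc σ1z (≢-sym (1≢b 1))
      Etr : ∀ {q'} → At M q' (btr q') → Exec x M q' σ2 (q' + 3) (set (set σ2 Tm 0) Ar (σ2 Ar + σ2 Tm)) (σ2 Tm * 3 + 1) Wr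
      Etr att = transfer-ex Tm Ar att (trans (U≠ (1≢b 1)) σ1z) (+-≢ bs (λ ())) (≢-sym (1≢b 3)) (≢-sym (1≢b 1))
      σ1T : σ1 Tm ≡ aa (suc j)
      σ1T = trans U= (trans (cong₂ _+_ σ0T (cong (eval x h) hv)) refl)
      σ2T : σ2 Tm ≡ aa (suc j)
      σ2T = trans (U≠ (+-≢ bs (λ ()))) σ1T
      σ1A : σ1 Ar ≡ aa j
      σ1A = trans (U≠ (+-≢ bs (λ ()))) σ0A
      tble : cost h mh + (σ1 Ar * 2 + 1 + (σ2 Tm * 3 + 1 + 1)) ≤ tb
      tble = ≤-trans (+-mono-≤ WhA (+-mono-≤ (+-monoˡ-≤ 1 (*-monoˡ-≤ 2 aA)) (+-monoˡ-≤ 1 aA')))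
               (≤-reflexive (lem A))
        where
        aA : σ1 Ar ≤ A
        aA = ≤-trans (≤-reflexive σ1A) (≤-trans (rec≤recCost g h m vals (λ i → ≤-trans (≤-reflexive (VP.lookup-map i ρ as)) (bd (suc i))) j)
                (AL.monoj m (≤-trans (n≤1+n j) jle)))
        aA' : σ2 Tm * 3 + 1 ≤ A * 3 + 1
        aA' = +-monoˡ-≤ 1 (*-monoˡ-≤ 3 (≤-trans (≤-reflexive σ2T) (≤-trans (rec≤recCost g h m vals (λ i → ≤-trans (≤-reflexive (VP.lookup-map i ρ as)) (bd (suc i))) (suc j))
                (AL.monoj m jle))))
        lem : ∀ A → A + (A * 2 + 1 + (A * 3 + 1 + 1)) ≡ 6 * A + 3
        lem = solve-∀
      pwb : ∀ k → set σ3 J (suc (σ3 J)) k ≡ Sf n k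
      pwb k with k ≟ J
      ... | yes refl = trans U= (trans (cong suc (trans (U≠ (J≢b 0)) (trans (U≠ (J≢b 2)) (trans (U≠ (J≢b 0)) (trans (U≠ (J≢b 2)) σ0J)))))
                         (trans (sub-suc n0 n lt) (sym (trans (U≠ (J≢b 1)) (trans (U≠ (J≢b 0)) U=)))))
      ... | no nJ with k ≟ Ar
      ...   | yes refl = trans (U≠ nJ) (trans U= (trans (cong₂ _+_ U= σ2T)
                           (trans (cong aa (sub-suc n0 n lt)) (sym (trans (U≠ (+-≢ bs (λ ()))) U=)))))
      ...   | no nA with k ≟ R
      ...     | yes refl = trans (U≠ nJ) (trans (U≠ nA) (trans (U≠ (+-≢ bs (λ ()))) (trans (U≠ nA) (trans (U≠ (+-≢ bs (λ ()))) (trans U= (sym U=))))))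
      ...     | no nR with k ≟ Tm
      ...       | yes refl = trans (U≠ nJ) (trans (U≠ nA) (trans U= (sym (trans (U≠ nR) (trans (U≠ nA) (trans (U≠ nJ) (trans (U≠ nR) (scrρ 3))))))))
      ...       | no nT = trans (U≠ nJ) (trans (U≠ nA) (trans (U≠ nT) (trans (U≠ nA) (trans (U≠ nT) (trans (U≠ nR) (trans (U≠ nR) (trans (U≠ nA) (trans (U≠ nJ) (sym (trans (U≠ nR) (trans (U≠ nA) (U≠ nJ))))))))))))

      iteration : ∀ {q} → At M (q + 1) (bodyB (q + 1)) →
                  Exec x M (q + 1) (set (Sf (suc n)) R n) (q + 1 + length (bodyB (q + 1))) (Sf n) tb Wr
      iteration {q} atb =
        ex-mono tble ≤-refl (ex-post pwb
          (seq-ex bh (bcl ⨾ btr ⨾ binc) (q + 1) Eh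
           (λ at → seq-ex bcl (btr ⨾ binc) _ Ecl
            (λ at → seq-ex btr binc _ Etr (inc-ex J _) at) at) atb))

    E3 : ∀ {q} → At M q (b3 q) → Exec x M q ρ2 (q + length (b3 q)) S0 (n0 * (tb + 2) + 1) Wr
    E3 {q} at3 = ex-pre pre3 (loop-ex R bodyB tb Sf q (λ n → U=)
                  (λ n → trans (U≠ (1≢b 2)) (trans (U≠ (1≢b 1)) (trans (U≠ 1≢J) ρ1z))) n0 (λ n lt → Iteration.iteration n lt) at3)
      where
      pre3 : ∀ k → ρ2 k ≡ Sf n0 k
      pre3 k with k ≟ R
      ... | yes refl = trans (U≠ (+-≢ bs (λ ()))) (trans U= (sym U=))
      ... | no nR with k ≟ Ar
      ...   | yes refl = trans U= (trans (cong₂ _+_ (trans (U≠ (+-≢ bs (λ ()))) (scrρ 1)) (cong (eval x g) vals1))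
                            (sym (trans (U≠ nR) (trans U= (cong aa (n∸n≡0 n0))))))
      ...   | no nA with k ≟ J
      ...     | yes refl = trans (U≠ nA) (trans (U≠ nR) (trans scrJ (sym (trans (U≠ nR) (trans (U≠ nA) (trans U= (n∸n≡0 n0)))))))
      ...     | no nJ = trans (U≠ nA) (sym (trans (U≠ nR) (trans (U≠ nA) (U≠ nJ))))
    S0z : S0 1 ≡ 0
    S0z = trans (U≠ (1≢b 2)) (trans (U≠ (1≢b 1)) (trans (U≠ 1≢J) ρ1z))
    E4 : ∀ {q} → At M q (b4 q) → Exec x M q S0 (q + 3) ρ4 (S0 Ar * 3 + 1) Wr
    E4 at4 = transfer-ex Ar out at4 S0z (≢-sym (ob 1)) (≢-sym (1≢b 1)) (Layout.out1 G)
    E5 : ∀ {q} → At M q (b5 q) → Exec x M q ρ4 (q + 2) (set ρ4 J 0) (ρ4 J * 2 + 1) Wr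
    E5 at5 = clear-ex J at5 (trans (U≠ (≢-sym (Layout.out1 G))) (trans (U≠ (1≢b 1)) S0z)) (≢-sym 1≢J)
    S0A : S0 Ar ≡ aa n0
    S0A = trans (U≠ (+-≢ bs (λ ()))) U=
    ρ4J : ρ4 J ≡ n0
    ρ4J = trans (U≠ (≢-sym oJ)) (trans (U≠ (J≢b 0)) (trans (U≠ (J≢b 1)) (trans (U≠ (J≢b 0)) U=)))
    fin : ∀ k → set ρ4 J 0 k ≡ set ρ out (ρ out + aa n0) k
    fin k with k ≟ J
    ... | yes refl = trans U= (sym (trans (U≠ (≢-sym oJ)) scrJ))
    ... | no nJ with k ≟ out
    ...   | yes refl = trans (U≠ nJ) (trans U= (trans (cong₂ _+_ (trans (U≠ (ob 2)) (trans (U≠ (ob 1)) (trans (U≠ oJ) (U≠ (ob 2))))) S0A) (sym U=)))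
    ...   | no no' with k ≟ Ar
    ...     | yes refl = trans (U≠ nJ) (trans (U≠ no') (trans U= (sym (trans (U≠ no') (scrρ 1)))))
    ...     | no nA with k ≟ R
    ...       | yes refl = trans (U≠ nJ) (trans (U≠ no') (trans (U≠ nA) (trans U= (sym (trans (U≠ no') (scrρ 2))))))
    ...       | no nR = trans (U≠ nJ) (trans (U≠ no') (trans (U≠ nA) (trans (U≠ nR) (trans (U≠ nA) (trans (U≠ nJ) (trans (U≠ nR) (sym (U≠ no')))))))) 
    tle : n0 * 4 + 1 + (n0 * 3 + 1) + (cost g m + (n0 * (tb + 2) + 1 + (S0 Ar * 3 + 1 + (ρ4 J * 2 + 1)))) ≤ Wr
    tle = ≤-trans (+-mono-≤ (+-mono-≤ (+-monoˡ-≤ 1 (*-monoˡ-≤ 4 nm)) (+-monoˡ-≤ 1 (*-monoˡ-≤ 3 nm)))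
                    (+-monoʳ-≤ (cost g m) (+-mono-≤ (+-monoˡ-≤ 1 (*-monoˡ-≤ (tb + 2) nm))
                       (+-mono-≤ (+-monoˡ-≤ 1 (*-monoˡ-≤ 3 aA)) (+-monoˡ-≤ 1 (*-monoˡ-≤ 2 (≤-trans (≤-reflexive ρ4J) nm)))))))
            (≤-trans (m≤m+n _ (m + 5)) (≤-reflexive (lem m (cost g m) A)))
      where
      nm : n0 ≤ m
      nm = bd zero
      aA : S0 Ar ≤ A
      aA = ≤-trans (≤-reflexive S0A) (≤-trans (rec≤recCost g h m vals (λ i → ≤-trans (≤-reflexive (VP.lookup-map i ρ as)) (bd (suc i))) n0) (AL.monoj m nm))
      lem : ∀ m wg A → m * 4 + 1 + (m * 3 + 1) + (wg + (m * (6 * A + 3 + 2) + 1 + (A * 3 + 1 + (m * 2 + 1)))) + (m + 5)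
                        ≡ wg + 10 * m + 10 + m * (6 * A + 5) + 3 * A
      lem = solve-∀

    correct : At M p0 (compile (rec g h) (a ∷ as) out bs p0) →
              Exec x M p0 ρ (p0 + length (compile (rec g h) (a ∷ as) out bs p0))
                   (set ρ out (ρ out + aa n0)) Wr Wr
    correct at =
      ex-mono tle ≤-refl (ex-post fin
       (seq-ex b1 (b2 ⨾ b3 ⨾ b4 ⨾ b5) p0 E1
        (λ at → seq-ex b2 (b3 ⨾ b4 ⨾ b5) _ E2
         (λ at → seq-ex b3 (b4 ⨾ b5) _ E3
          (λ at → seq-ex b4 b5 _ E4 E5 at) at) at) at))

  correct-rec : ∀ x xB {k} (g : Prim true k) (h : Prim true (suc (suc k))) →
                Spec.Correct x xB g → Spec.Correct x xB h → Spec.Correct x xB (rec g h)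
  correct-rec x xB g h sg sh M (a ∷ as) out bs ρ m p0 G bd = RecPhases.correct x xB g h sg sh M a as out bs ρ m p0 G bd

  mainProgram : Prim true 1 → Block
  mainProgram p = transferC 0 2 ⨾ compile p (2 ∷ []) 0 3

  fetch-end : ∀ (M : Program) → fetch M (length M) ≡ nothing
  fetch-end [] = refl
  fetch-end (i ∷ M) = fetch-end M

  ρi : ℕ → ℕ → ℕ
  ρi n = update (λ _ → 0) 0 n

  module Main (x : ℕ → ℕ) (xB : ∀ j → x j ≤ B j) where
    open Spec x xB
    open SpecComp x xB

    mutual
      compile-correct : ∀ {k} (p : Prim true k) → Correct p
      compile-correct Z = correct-Z
      compile-correct S = correct-S
      compile-correct (P i) = correct-P i
      compile-correct orc = correct-orc
      compile-correct (comp g hs) = correct-comp g hs (compile-correct g) (compileVec-correct hs)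
      compile-correct (rec g h) = correct-rec x xB g h (compile-correct g) (compile-correct h)

      compileVec-correct : ∀ {k j} (hs : Vec (Prim true k) j) → CorrectVec hs
      compileVec-correct [] = correct-[]
      compileVec-correct (h ∷ hs) = correct-∷ h hs (compile-correct h) (compileVec-correct hs)

    main-correct : ∀ (p : Prim true 1) n → Exec x (mainProgram p 0) 0 (ρi n) (0 + length (mainProgram p 0))
               (set (set (set (ρi n) 0 0) 2 (ρi n 2 + ρi n 0)) 0 (0 + eval x p (n ∷ []))) (n * 3 + 1 + cost p n) (cost p n)
    main-correct p n = seq-ex (transferC 0 2) (compile p (2 ∷ []) 0 3) 0
      (λ at → transfer-ex 0 2 at refl (λ ()) (λ ()) (λ ()))
      (λ at → ex-post pw (compile-correct p (mainProgram p 0) (2 ∷ []) 0 3 ρ' n _ G (λ { zero → ≤-reflexive r2 }) at))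
      (at-self (mainProgram p 0))
      where
      ρ' : ℕ → ℕ
      ρ' = set (set (ρi n) 0 0) 2 (ρi n 2 + ρi n 0)
      r2 : ρ' 2 ≡ n
      r2 = U=
      r0 : ρ' 0 ≡ 0
      r0 = trans (U≠ (λ ())) U=
      G : Layout ρ' (2 ∷ []) 0 3
      G = record { z1 = trans (U≠ (λ ())) (trans (U≠ (λ ())) refl)
                 ; scr = λ { (suc (suc (suc j))) _ → trans (U≠ (λ ())) (trans (U≠ (λ ())) refl) ; zero () ; (suc zero) (s≤s ()) ; (suc (suc zero)) (s≤s (s≤s ())) }
                 ; bs2 = s≤s (s≤s z≤n) ; outlt = s≤s z≤n ; out1 = λ ()
                 ; arglt = λ { zero → s≤s (s≤s (s≤s z≤n)) } ; argout = λ { zero () } ; arg1 = λ { zero () } }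
      pw : ∀ k → set ρ' 0 (ρ' 0 + eval x p (V.map ρ' (2 ∷ []))) k ≡ set ρ' 0 (0 + eval x p (n ∷ [])) k
      pw k = set-cong 0 (λ _ → refl) (cong₂ _+_ r0 (cong (λ z → eval x p (z ∷ [])) r2)) k

module CostPR (B : ℕ → ℕ) (Bmono : ∀ {a b} → a ≤ b → B a ≤ B b) (rB : ∀ {o} → PrimRep.Rep o {1} (λ _ v → B (head v))) where

  open import Defs
  open PrimRep
  open Compile B Bmono
  open import Data.Nat
  open import Data.Bool using (true)
  open import Relation.Binary.PropositionalEquality

  rRecCost : ∀ {o} {wg wh : ℕ → ℕ} → Rep o {1} (λ _ v → wg (head v)) → Rep o {1} (λ _ v → wh (head v)) →
         Rep o {2} (λ _ v → recCost wg wh (lookup v #1) (head v))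
  rRecCost {o} {wg} {wh} rg rh =
    ext {F = Rec (λ _ v → wg (lookup v #0) + lookup v #0) (λ _ v → wh (lookup v #1 + lookup v #0) + lookup v #1 + lookup v #0 + 1)}
        (rR ((rg · rP #0) ⊕ rP #0) ((((rh · (rP #1 ⊕ rP #0)) ⊕ rP #1) ⊕ rP #0) ⊕ rK 1)) pf
    where
    pf : ∀ x v → Rec (λ _ v → wg (lookup v #0) + lookup v #0) (λ _ v → wh (lookup v #1 + lookup v #0) + lookup v #1 + lookup v #0 + 1) x v
               ≡ recCost wg wh (lookup v #1) (head v)
    pf x (zero ∷ m ∷ []) = refl
    pf x (suc j ∷ m ∷ []) = cong (λ r → wh (r + j) + r + j + 1) (pf x (j ∷ m ∷ []))

  mutual
    rCost : ∀ {o k} (p : Prim true k) → Rep o {1} (λ _ v → cost p (head v))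
    rCost Z = ext (rP #0) λ { x (m ∷ []) → refl }
    rCost S = ext ((rK 8 ⊗ rP #0) ⊕ rK 8) λ { x (m ∷ []) → refl }
    rCost (P i) = ext ((rK 8 ⊗ rP #0) ⊕ rK 8) λ { x (m ∷ []) → refl }
    rCost orc = ext (((rK 3 ⊗ (rB · rP #0)) ⊕ rP #0) ⊕ rK 2) λ { x (m ∷ []) → refl }
    rCost (comp {m = j} g hs) =
      ext ((((rCost g · rCostVec hs) ⊕ rCostVec hs) ⊕ (rK j ⊗ ((rK 2 ⊗ rCostVec hs) ⊕ rK 1))) ⊕ rP #0) λ { x (m ∷ []) → refl }
    rCost (rec g h) =
      ext (((((rCost g · rP #0) ⊕ (rK 10 ⊗ rP #0)) ⊕ rK 10) ⊕ (rP #0 ⊗ ((rK 6 ⊗ A) ⊕ rK 5))) ⊕ (rK 3 ⊗ A)) λ { x (m ∷ []) → refl }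
      where
      A = rC (rRecCost (rCost g) (rCost h)) (rP #0 ∷ʳ rP #0 ∷ʳ []ʳ)

    rCostVec : ∀ {o k j} (hs : Vec (Prim true k) j) → Rep o {1} (λ _ v → costVec hs (head v))
    rCostVec [] = ext rZ λ { x (m ∷ []) → refl }
    rCostVec (h ∷ hs) = ext (rCost h ⊕ rCostVec hs) λ { x (m ∷ []) → refl }

-- A configuration with
-- registers below R is coded as code (pc ∷ [r 0, …, r (R - 1)]).  The oracle of the
-- simulated machine is O x a, where the extra parameter a lets the same development
-- serve both for the real oracle x and for an oracle read from a code (no-lookahead part).
module Simulation (O : (ℕ → ℕ) → ℕ → ℕ → ℕ) {o : Bool} (rOr : PrimRep.Rep o {2} (λ x v → O x (lookup v PrimRep.#1) (head v))) (R : ℕ) where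

  open import Defs
  open PrimRep
  open StringCode
  open StringCodePR
  open StringIndex
  open NatFacts
  open Machine using (exec-dec0; exec-decS; step-just; step-halt)
  open import Data.Nat
  open import Data.Nat.Properties
  open import Data.List using ([]; _∷_; applyUpTo)
  open import Data.List.Relation.Unary.All using (All; []; _∷_)
  open import Data.Maybe using (Maybe; just; nothing)
  open import Data.Product using (_,_)
  open import Relation.Binary.PropositionalEquality
  open import Relation.Nullary using (yes; no)

  encConfig : Config → ℕ
  encConfig c = code (pc c ∷ applyUpTo (reg c) R)

  entry : ℕ → ℕ → ℕ
  entry c i = nthC i c

  regsN : (ℕ → ℕ) → ℕ → ℕ → ℕ
  regsN F k zero = 0
  regsN F k (suc n) = cons (F k) (regsN F (suc k) n)

  rebuild : ℕ → (ℕ → ℕ) → ℕ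
  rebuild p F = cons p (regsN F 0 R)

  execCode : (ℕ → ℕ) → Instr → ℕ → ℕ
  execCode y (inc r) c = rebuild (suc (entry c 0)) (λ k → entry c (suc k) + eqn k r)
  execCode y (decjz r j) c = ifz (entry c (suc r)) (rebuild j (λ k → entry c (suc k))) (rebuild (suc (entry c 0)) (λ k → entry c (suc k) ∸ eqn k r))
  execCode y (query r s) c = rebuild (suc (entry c 0)) (λ k → ifz (eqn k r) (entry c (suc k)) (y (entry c (suc s))))

  stepCode : (ℕ → ℕ) → Program → ℕ → ℕ → ℕ
  stepCode y [] idx c = c
  stepCode y (i ∷ M) idx c = ifz (eqn (entry c 0) idx) (stepCode y M (suc idx) c) (execCode y i c)

  initCode : ℕ → ℕ
  initCode n = rebuild 0 (λ k → ifz k n 0)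

  simCode : (ℕ → ℕ) → Program → ℕ → ℕ → ℕ
  simCode y M zero n = initCode n
  simCode y M (suc s) n = stepCode y M 0 (simCode y M s n)

  open RegisterRuns using (InsOK)

  entry-pc : ∀ c → entry (encConfig c) 0 ≡ pc c
  entry-pc c = nthC-code 0 (pc c ∷ applyUpTo (reg c) R)

  entry-reg : ∀ c k → k < R → entry (encConfig c) (suc k) ≡ reg c k
  entry-reg c k lt = trans (nthC-code (suc k) (pc c ∷ applyUpTo (reg c) R)) (nthL-app (reg c) R k lt)

  regsN-code : ∀ F k n → regsN F k n ≡ code (applyUpTo (λ i → F (k + i)) n)
  regsN-code F k zero = refl
  regsN-code F k (suc n) = cong₂ cons (cong F (sym (+-identityʳ k)))
    (trans (regsN-code F (suc k) n) (cong code (app-cong (λ i → F (suc k + i)) (λ i → F (k + suc i)) n (λ i _ → cong F (sym (+-suc k i))))))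

  rebuild-correct : ∀ p F (ρ : ℕ → ℕ) → (∀ k → k < R → F k ≡ ρ k) → rebuild p F ≡ encConfig ⟨ p , ρ ⟩
  rebuild-correct p F ρ e = cong (cons p) (trans (regsN-code F 0 R) (cong code (app-cong F ρ R e)))

  open Machine using (upd-eq; upd-ne)

  execCode-correct : ∀ y i c → InsOK R i → execCode y i (encConfig c) ≡ encConfig (exec y i c)
  execCode-correct y (inc r) c lt =
    trans (cong (λ p → rebuild (suc p) F) (entry-pc c)) (rebuild-correct (suc (pc c)) F _ pw)
    where
    F : ℕ → ℕ
    F = λ k → entry (encConfig c) (suc k) + eqn k r
    pw : ∀ k → k < R → entry (encConfig c) (suc k) + eqn k r ≡ update (reg c) r (suc (reg c r)) k
    pw k kl with k ≟ r
    ... | yes refl = trans (cong₂ _+_ (entry-reg c k kl) (eqn-refl k)) (trans (+-comm _ 1) (sym (upd-eq (reg c) k _)))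
    ... | no ne = trans (cong₂ _+_ (entry-reg c k kl) (eqn-ne k r ne)) (trans (+-identityʳ _) (sym (upd-ne (reg c) r _ k ne)))
  execCode-correct y (decjz r j) c lt = dj (reg c r) refl
    where
    F1 : ℕ → ℕ
    F1 = λ k → entry (encConfig c) (suc k)
    F2 : ℕ → ℕ
    F2 = λ k → entry (encConfig c) (suc k) ∸ eqn k r
    A1 : ℕ
    A1 = rebuild j F1
    A2 : ℕ
    A2 = rebuild (suc (entry (encConfig c) 0)) F2
    dj : ∀ w → reg c r ≡ w → execCode y (decjz r j) (encConfig c) ≡ encConfig (exec y (decjz r j) c)
    dj zero e = trans (cong (λ z → ifz z A1 A2) (trans (entry-reg c r lt) e))
                 (trans (rebuild-correct j F1 (reg c) (λ k kl → entry-reg c k kl)) (cong encConfig (sym (exec-dec0 y r j c e))))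
    dj (suc w) e = trans (cong (λ z → ifz z A1 A2) (trans (entry-reg c r lt) e))
                 (trans (cong (λ p → rebuild (suc p) F2) (entry-pc c))
                   (trans (rebuild-correct (suc (pc c)) F2 (update (reg c) r w) pw) (cong encConfig (sym (exec-decS y r j c w e)))))
      where
      pw : ∀ k → k < R → entry (encConfig c) (suc k) ∸ eqn k r ≡ update (reg c) r w k
      pw k kl with k ≟ r
      ... | yes refl = trans (cong₂ _∸_ (trans (entry-reg c k kl) e) (eqn-refl k)) (sym (upd-eq (reg c) k w))
      ... | no ne = trans (cong₂ _∸_ (entry-reg c k kl) (eqn-ne k r ne)) (sym (upd-ne (reg c) r w k ne))
  execCode-correct y (query r s) c (lt , ls) =
    trans (cong (λ p → rebuild (suc p) F) (entry-pc c)) (rebuild-correct (suc (pc c)) F _ pw)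
    where
    F : ℕ → ℕ
    F = λ k → ifz (eqn k r) (entry (encConfig c) (suc k)) (y (entry (encConfig c) (suc s)))
    pw : ∀ k → k < R → ifz (eqn k r) (entry (encConfig c) (suc k)) (y (entry (encConfig c) (suc s))) ≡ update (reg c) r (y (reg c s)) k
    pw k kl with k ≟ r
    ... | yes refl = trans (cong (λ z → ifz z (entry (encConfig c) (suc k)) (y (entry (encConfig c) (suc s)))) (eqn-refl k)) (trans (cong y (entry-reg c s ls)) (sym (upd-eq (reg c) k _)))
    ... | no ne = trans (cong (λ z → ifz z (entry (encConfig c) (suc k)) (y (entry (encConfig c) (suc s)))) (eqn-ne k r ne)) (trans (entry-reg c k kl) (sym (upd-ne (reg c) r _ k ne)))

  caseF : (ℕ → ℕ) → Maybe Instr → Config → ℕ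
  caseF y nothing c = encConfig c
  caseF y (just i) c = encConfig (exec y i c)

  dispatch-correct : ∀ y M idx c → All (InsOK R) M → idx ≤ pc c → stepCode y M idx (encConfig c) ≡ caseF y (fetch M (pc c ∸ idx)) c
  dispatch-correct y [] idx c _ _ = refl
  dispatch-correct y (i ∷ M) idx c (ok ∷ oks) le with pc c ≟ idx
  ... | yes refl = trans (cong (λ z → ifz z (stepCode y M (suc idx) (encConfig c)) (execCode y i (encConfig c))) (trans (cong (λ z → eqn z (pc c)) (entry-pc c)) (eqn-refl (pc c))))
                     (trans (execCode-correct y i c ok) (cong (λ z → caseF y (fetch (i ∷ M) z) c) (sym (n∸n≡0 (pc c)))))
  ... | no ne = trans (cong (λ z → ifz z (stepCode y M (suc idx) (encConfig c)) (execCode y i (encConfig c))) (trans (cong (λ z → eqn z idx) (entry-pc c)) (eqn-ne (pc c) idx ne)))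
                  (trans (dispatch-correct y M (suc idx) c oks (≤∧≢⇒< le (λ e → ne (sym e))))
                     (cong (λ z → caseF y (fetch (i ∷ M) z) c) (sub-suc (pc c) idx (≤∧≢⇒< le (λ e → ne (sym e))))))

  stepCode-correct : ∀ y M c → All (InsOK R) M → stepCode y M 0 (encConfig c) ≡ encConfig (step y M c)
  stepCode-correct y M c oks = st (fetch M (pc c)) refl
    where
    st : ∀ m → fetch M (pc c) ≡ m → stepCode y M 0 (encConfig c) ≡ encConfig (step y M c)
    st nothing e = trans (dispatch-correct y M 0 c oks z≤n) (trans (cong (λ z → caseF y z c) e) (cong encConfig (sym (step-halt y M c e))))
    st (just i) e = trans (dispatch-correct y M 0 c oks z≤n) (trans (cong (λ z → caseF y z c) e) (cong encConfig (sym (step-just y M c i e))))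

  simCode-correct : ∀ y M s n → All (InsOK R) M → simCode y M s n ≡ encConfig (run y M s (init n))
  simCode-correct y M zero n oks = rebuild-correct 0 _ _ (λ { zero _ → refl ; (suc k) _ → refl })
  simCode-correct y M (suc s) n oks = trans (cong (stepCode y M 0) (simCode-correct y M s n oks)) (stepCode-correct y M _ oks)

  Y : (ℕ → ℕ) → Vec ℕ 2 → ℕ → ℕ
  Y x v = O x (lookup v #1)

  rEntry : ∀ i → Rep o {2} (λ x v → entry (head v) i)
  rEntry i = ext (rC rNth (rK i ∷ʳ rP #0 ∷ʳ []ʳ)) λ { x (c ∷ a ∷ []) → refl }

  rRegs : ∀ (Fm : (ℕ → ℕ) → Vec ℕ 2 → ℕ → ℕ) → (∀ k → Rep o {2} (λ x v → Fm x v k)) → ∀ k n → Rep o {2} (λ x v → regsN (Fm x v) k n)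
  rRegs Fm rF k zero = rK 0
  rRegs Fm rF k (suc n) = ext (rC rCons (rF k ∷ʳ rRegs Fm rF (suc k) n ∷ʳ []ʳ)) λ x v → refl

  rRebuild : ∀ {Pm : (ℕ → ℕ) → Vec ℕ 2 → ℕ} (Fm : (ℕ → ℕ) → Vec ℕ 2 → ℕ → ℕ) → Rep o {2} Pm → (∀ k → Rep o {2} (λ x v → Fm x v k)) →
             Rep o {2} (λ x v → rebuild (Pm x v) (Fm x v))
  rRebuild Fm rp rF = ext (rC rCons (rp ∷ʳ rRegs Fm rF 0 R ∷ʳ []ʳ)) λ x v → refl

  rExecCode : ∀ i → Rep o {2} (λ x v → execCode (Y x v) i (head v))
  rExecCode (inc r) = ext (rRebuild (λ x v k → entry (head v) (suc k) + eqn k r) (rS · rEntry 0)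
                        (λ k → rEntry (suc k) ⊕ rC rEq (rK k ∷ʳ rK r ∷ʳ []ʳ))) λ { x (c ∷ a ∷ []) → refl }
  rExecCode (decjz r j) = ext (rIf (rEntry (suc r))
                            (rRebuild (λ x v k → entry (head v) (suc k)) (rK j) (λ k → rEntry (suc k)))
                            (rRebuild (λ x v k → entry (head v) (suc k) ∸ eqn k r) (rS · rEntry 0)
                               (λ k → rEntry (suc k) ⊖ rC rEq (rK k ∷ʳ rK r ∷ʳ []ʳ)))) λ { x (c ∷ a ∷ []) → refl }
  rExecCode (query r s) = ext (rRebuild (λ x v k → ifz (eqn k r) (entry (head v) (suc k)) (Y x v (entry (head v) (suc s)))) (rS · rEntry 0)
                            (λ k → rIf (rC rEq (rK k ∷ʳ rK r ∷ʳ []ʳ)) (rEntry (suc k)) (rC rOr (rEntry (suc s) ∷ʳ rP #1 ∷ʳ []ʳ))))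
                        λ { x (c ∷ a ∷ []) → refl }

  rStepCode : ∀ M idx → Rep o {2} (λ x v → stepCode (Y x v) M idx (head v))
  rStepCode [] idx = ext (rP #0) λ { x (c ∷ a ∷ []) → refl }
  rStepCode (i ∷ M) idx = ext (rIf (rC rEq (rEntry 0 ∷ʳ rK idx ∷ʳ []ʳ)) (rStepCode M (suc idx)) (rExecCode i)) λ { x (c ∷ a ∷ []) → refl }

  rInitCode : Rep o {2} (λ x v → initCode (head v))
  rInitCode = ext (rRebuild (λ x v k → ifz k (lookup v #0) 0) (rK 0) (λ k → rIf (rK k) (rP #0) (rK 0))) λ { x (c ∷ a ∷ []) → refl }

  rSimCode : ∀ M → Rep o {3} (λ x v → simCode (O x (lookup v #2)) M (head v) (lookup v #1))
  rSimCode M = ext {F = Rec (λ x v → initCode (head v)) (λ x v → stepCode (O x (lookup v #3)) M 0 (lookup v #1))}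
               (rR rInitCode (rC (rStepCode M 0) (rP #1 ∷ʳ rP #3 ∷ʳ []ʳ))) pf
    where
    pf : ∀ x v → Rec (λ x v → initCode (head v)) (λ x v → stepCode (O x (lookup v #3)) M 0 (lookup v #1)) x v
                 ≡ simCode (O x (lookup v #2)) M (head v) (lookup v #1)
    pf x (zero ∷ n ∷ a ∷ []) = refl
    pf x (suc s ∷ n ∷ a ∷ []) = cong (stepCode (O x a) M 0) (pf x (s ∷ n ∷ a ∷ []))

  rOut : ∀ {k} M {N AX : (ℕ → ℕ) → Vec ℕ k → ℕ} {t : ℕ → ℕ} → Rep o N → Rep o AX → Rep o {1} (λ _ v → t (head v)) →
         Rep o {k} (λ x v → entry (simCode (O x (AX x v)) M (t (N x v)) (N x v)) 1)
  rOut M rN rA rT = ext (rC rNth (rK 1 ∷ʳ rC (rSimCode M) ((rT · rN) ∷ʳ rN ∷ʳ rA ∷ʳ []ʳ) ∷ʳ []ʳ)) λ x v → refl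

-- (1 ⇒ 2): a primitive recursive time function t makes f a primitive recursive
-- functional: simulate t n steps of M and read register 0.
module FromTimeFn where

  open import Defs
  open PrimRep
  open RegisterRuns
  open import Data.Nat
  open import Data.Bool using (true)
  open import Data.Vec using ([]; _∷_; lookup; head)
  open import Data.Product using (_,_)
  open import Relation.Binary.PropositionalEquality

  timeFn⇒prFunctional : ∀ I f → HasPRTimeFn I f → IsPRFunctional I f
  timeFn⇒prFunctional I f (M , t , tpr , tf) = tm repA , pf
    where
    rOr : Rep true {2} (λ x v → x (head v))
    rOr = ext (rO · rP #0) λ { x (p ∷ a ∷ []) → refl }
    open Simulation (λ x aux pos → x pos) rOr (Rm M)
    repA : Rep true {1} (λ x v → entry (simCode (λ pos → x pos) M (t (lookup v #0)) (lookup v #0)) 1)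
    repA = rOut M {t = t} (rP #0) rZ (rPR1 tpr)
    pf : ∀ x → Path I x → ∀ n → eval x (tm repA) (n ∷ []) ≡ f x n
    pf x px n with tf x px n
    ... | s , s≤ , hl , oe , _ , _ =
      trans (ok repA x (n ∷ []))
       (trans (cong (λ c → entry c 1) (simCode-correct x M (t n) n (allOK M)))
        (trans (entry-reg (run x M (t n) (init n)) 0 (Rm-pos M))
         (trans (cong (λ c → reg c 0) (run-tn x M s (t n) (init n) s≤ hl)) oe)))

-- (2 ⇒ 1): the compiled program of a primitive recursive functional has the
-- primitive recursive time function n * 3 + 1 + cost p n.
module ToTimeFn where

  open import Defs
  open PrimRep
  open Machine using (Exec; set; U=)
  open import Data.Nat
  import Data.Fin
  open import Data.Nat.Properties
  open import Data.Bool using (true)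
  open import Data.Vec using ([]; _∷_; lookup; head)
  open import Data.List using ([]; _∷_; length; upTo)
  open import Data.List.Relation.Unary.All using (All)
  import Data.List.Relation.Unary.All as All
  import Data.List.Relation.Unary.All.Properties as AllP
  import Data.List.Properties as LP
  open import Data.List.Membership.Propositional.Properties using (∈-upTo⁺)
  open import Data.Product using (_,_)
  open import Relation.Binary.PropositionalEquality

  -- Partial sums of the branching bound, a monotone majorant of it.
  boundSum : (ℕ → ℕ) → ℕ → ℕ
  boundSum b zero = 0
  boundSum b (suc i) = boundSum b i + b i

  boundSum-mono : ∀ b {i j} → i ≤ j → boundSum b i ≤ boundSum b j
  boundSum-mono b {i} {j} le with ≤⇒≤′ le
  ... | ≤′-refl = ≤-refl
  ... | ≤′-step le' = ≤-trans (boundSum-mono b (≤′⇒≤ le')) (m≤m+n _ _)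

  -- Along a path, x j is bounded by b (j + 1), since x ↾ (j + 1) ∈ I.
  path-bound : ∀ I x → Path I x → ∀ j → x j ≤ b I (suc j)
  path-bound I x px j = subst (λ L → x j ≤ b I L) lenEq (All.lookup (AllP.map⁻ (bounded I (x ↾ suc j) (px (suc j)))) (∈-upTo⁺ (n<1+n j)))
    where
    lenEq : length (x ↾ suc j) ≡ suc j
    lenEq = trans (LP.length-map x (upTo (suc j))) (LP.length-upTo (suc j))

  -- A primitive recursive, monotone bound on the oracle values along the paths of I:
  -- x j ≤ b (j + 1) ≤ b 0 + … + b (j + 1).
  module PathBound (I : PRBTree) where
    B : ℕ → ℕ
    B j = boundSum (b I) (suc (suc j))

    Bmono : ∀ {a c} → a ≤ c → B a ≤ B c
    Bmono le = boundSum-mono (b I) (s≤s (s≤s le))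

    rB : ∀ {o} → Rep o {1} (λ _ v → B (head v))
    rB = ext (rBs · (rS · rS · rP #0)) λ { x (j ∷ []) → refl }
      where
      rBs : ∀ {o} → Rep o {1} (λ _ v → boundSum (b I) (head v))
      rBs {o} = ext {F = Rec (λ _ _ → 0) (λ _ v → lookup v #1 + b I (lookup v #0))} (rR rZ (rP #1 ⊕ rPR1 (b-pr I) · rP #0)) pf'
        where
        pf' : ∀ x v → Rec (λ _ _ → 0) (λ _ v → lookup v #1 + b I (lookup v #0)) x v ≡ boundSum (b I) (head v)
        pf' x (zero ∷ []) = refl
        pf' x (suc i ∷ []) = cong (_+ b I i) (pf' x (i ∷ []))

    path≤B : ∀ x → Path I x → ∀ j → x j ≤ B j
    path≤B x px j = ≤-trans (path-bound I x px j) (m≤n+m _ _)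

  module CompiledTimeFn (I : PRBTree) (f : (ℕ → ℕ) → ℕ → ℕ) (p : Prim true 1)
                        (pf : ∀ x → Path I x → ∀ n → eval x p (n ∷ []) ≡ f x n) where
    open PathBound I
    open Compile B Bmono
    open CompileRec B Bmono
    open CostPR B Bmono rB

    M : Program
    M = mainProgram p 0

    t : ℕ → ℕ
    t n = n * 3 + 1 + cost p n

    tpr : IsPR1 t
    tpr = toPR1 (ext ((rP #0 ⊗ rK 3 ⊕ rK 1) ⊕ rCost p) λ { x (n ∷ []) → refl })

    tf : TimeFn I f M t
    tf x px n with Main.main-correct x (path≤B x px) p n (init n) refl (λ k → refl)
    ... | s , s≤ , pce , rge , qb = s , s≤ , halted , oeq , ole , qs
      where
      c' : Config
      c' = run x M s (init n)
      halted : Halted M c'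
      halted = trans (cong (fetch M) pce) (fetch-end M)
      o1 : output c' ≡ eval x p (n ∷ [])
      o1 = trans (rge 0) U=
      oeq : output c' ≡ f x n
      oeq = trans o1 (pf x px n)
      ole : output c' ≤ t n
      ole = ≤-trans (≤-reflexive o1) (≤-trans (ValueBound.value≤cost x (path≤B x px) p n (n ∷ []) (λ { Data.Fin.zero → ≤-refl })) (m≤n+m _ _))
      qs : ∀ i → i < s → QueryBelow M (run x M i (init n)) (t n)
      qs i lt r s' e = ≤-trans (qb i lt r s' e) (m≤n+m _ _)

  prFunctional⇒timeFn : ∀ I f → IsPRFunctional I f → HasPRTimeFn I f
  prFunctional⇒timeFn I f (p , pf) = M , t , tpr , tf
    where open CompiledTimeFn I f p pf

module LookaheadTree (I : PRBTree) (t : ℕ → ℕ) (tpr : IsPR1 t) (tmono : Nondecreasing t) where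

  open PrimRep
  open StringCode
  open StringCodePR
  open StringIndex
  open StringOps
  open import Data.Nat
  open import Data.Nat.Properties
  open import Data.Vec using ([]; _∷_; lookup; head)
  open import Data.List using (List; []; _∷_; length; drop; take; applyUpTo; _++_; map)
  import Data.List.Properties as LP
  open import Data.List.Relation.Unary.All using (All; []; _∷_)
  import Data.List.Relation.Unary.All as All
  open import Data.Product using (_,_; _×_; ∃-syntax)
  open import Relation.Binary.PropositionalEquality
  open import Function.Bundles using (_⇔_; mk⇔)

  Φ : ℕ → List ℕ → List ℕ
  Φ n σ = applyUpTo (λ k → code (take (t k) σ)) (suc n)

  Φcode : ℕ → ℕ → ℕ
  Φcode n e = bldL (λ k → takeC (t k) e) (suc n)

  -- c codes an I′-node of length n + 1 with last entry e: e codes a node of I of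
  -- length t n and c = code (Φ n (decode e)).
  chk : ℕ → ℕ → ℕ → ℕ
  chk c n e = eqn (χ I e) 1 * eqn (lenC e) (t n) * eqn c (Φcode n e)

  -- Membership in I′: the empty string, or the test chk on the decoded last entry.
  χ' : ℕ → ℕ
  χ' c = ifz c 1 (chk c (lenC c ∸ 1) (nthC (lenC c ∸ 1) c))

  -- The branching bound of I′: every entry of an I′-node of length L codes a node
  -- of I of length t (L ∸ 1), hence is below 2 ^ ((b + 1) * t (L ∸ 1)).
  b' : ℕ → ℕ
  b' L = 2 ^ ((b I (t (L ∸ 1)) + 1) * t (L ∸ 1))

  rT : ∀ {o} → Rep o {1} (λ _ v → t (head v))
  rT = rPR1 tpr

  rHΦ : ∀ {o} → Rep o {2} (λ _ v → Φcode (head v) (lookup v #1))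
  rHΦ = ext (rC (rBld {F = λ p e → takeC (t p) e} (ext (rC rTakeC (rT · rP #0 ∷ʳ rP #1 ∷ʳ []ʳ)) λ { x (p ∷ e ∷ []) → refl })) (rS · rP #0 ∷ʳ rP #1 ∷ʳ []ʳ))
            λ { x (n ∷ e ∷ []) → refl }

  rχ : ∀ {o} → Rep o {1} (λ _ v → χ I (head v))
  rχ = rPR1 (χ-pr I)

  rChk : ∀ {o} → Rep o {3} (λ _ v → chk (head v) (lookup v #1) (lookup v #2))
  rChk = ext (rC rEq (rχ · rP #2 ∷ʳ rK 1 ∷ʳ []ʳ) ⊗ rC rEq (rLenC · rP #2 ∷ʳ rT · rP #1 ∷ʳ []ʳ) ⊗ rC rEq (rP #0 ∷ʳ rC rHΦ (rP #1 ∷ʳ rP #2 ∷ʳ []ʳ) ∷ʳ []ʳ))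
             λ { x (c ∷ n ∷ e ∷ []) → refl }

  rχ' : ∀ {o} → Rep o {1} (λ _ v → χ' (head v))
  rχ' {o} = ext (rIf (rP #0) (rK 1) (rC rChk (rP #0 ∷ʳ N ∷ʳ rC rNth (N ∷ʳ rP #0 ∷ʳ []ʳ) ∷ʳ []ʳ))) λ { x (c ∷ []) → refl }
    where
    N : Rep o {1} (λ _ v → lenC (lookup v #0) ∸ 1)
    N = rLenC · rP #0 ⊖ rK 1

  rb' : ∀ {o} → Rep o {1} (λ _ v → b' (head v))
  rb' = ext (rPow2 · ((rPR1 (b-pr I) · rT · (rP #0 ⊖ rK 1) ⊕ rK 1) ⊗ rT · (rP #0 ⊖ rK 1))) λ { x (L ∷ []) → refl }

  Φcode-correct : ∀ n σ → Φcode n (code σ) ≡ code (Φ n σ)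
  Φcode-correct n σ = trans (bldL-ok (λ k → takeC (t k) (code σ)) (suc n)) (cong code (app-cong _ _ (suc n) (λ k _ → takeC-ok (t k) σ)))

  Mem-pre : ∀ s w → Mem I (s ++ w) → Mem I s
  Mem-pre s [] m = subst (Mem I) (LP.++-identityʳ s) m
  Mem-pre s (a ∷ w) m = prefix-closed I s a (Mem-pre (s ++ a ∷ []) w (subst (Mem I) (sym (LP.++-assoc s (a ∷ []) w)) m))

  Mem-take : ∀ j σ → Mem I σ → Mem I (take j σ)
  Mem-take j σ m = Mem-pre (take j σ) (drop j σ) (subst (Mem I) (sym (LP.take++drop≡id j σ)) m)

  ifz-pos : ∀ c a b' → 0 < c → ifz c a b' ≡ b'
  ifz-pos (suc c) a b' _ = refl

  code-pos' : ∀ ρ → 0 < length ρ → 0 < code ρ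
  code-pos' (a ∷ ρ) _ = code-pos a ρ

  lenΦ : ∀ n σ → length (Φ n σ) ≡ suc n
  lenΦ n σ = LP.length-applyUpTo (λ k → code (take (t k) σ)) (suc n)

  lastΦ : ∀ n σ → length σ ≡ t n → nthL (Φ n σ) n ≡ code σ
  lastΦ n σ e = trans (nthL-app (λ k → code (take (t k) σ)) (suc n) n ≤-refl) (cong code (LP.take-all (t n) σ (≤-reflexive e)))

  intro : ∀ n σ → Mem I σ → length σ ≡ t n → χ' (code (Φ n σ)) ≡ 1
  intro n σ m e =
    trans (ifz-pos c 1 _ (code-pos' (Φ n σ) (≤-trans (s≤s z≤n) (≤-reflexive (sym (lenΦ n σ))))))
     (trans (cong₂ (chk c) eN eE)
       (cong₂ _*_ (cong₂ _*_ (trans (cong (λ z → eqn z 1) m) refl) (trans (cong (λ z → eqn z (t n)) (trans (lenC-code σ) e)) (eqn-refl (t n))))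
                  (trans (cong (eqn c) (Φcode-correct n σ)) (eqn-refl c))))
    where
    c : ℕ
    c = code (Φ n σ)
    eN : lenC c ∸ 1 ≡ n
    eN = cong (_∸ 1) (trans (lenC-code (Φ n σ)) (lenΦ n σ))
    eE : nthC (lenC c ∸ 1) c ≡ code σ
    eE = trans (cong (λ z → nthC z c) eN) (trans (nthC-code n (Φ n σ)) (lastΦ n σ e))

  elim : ∀ ρ → 0 < length ρ → χ' (code ρ) ≡ 1 →
         ∃[ σ ] (Mem I σ × length σ ≡ t (length ρ ∸ 1) × ρ ≡ Φ (length ρ ∸ 1) σ)
  elim ρ lp m with code-surj E
    where
    c : ℕ
    c = code ρ
    N : ℕ
    N = lenC c ∸ 1
    E : ℕ
    E = nthC N c
  ... | σ , eσ = σ , memσ , lenσ , ρeq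
    where
    c : ℕ
    c = code ρ
    eN : lenC c ∸ 1 ≡ length ρ ∸ 1
    eN = cong (_∸ 1) (lenC-code ρ)
    N : ℕ
    N = lenC c ∸ 1
    E : ℕ
    E = nthC N c
    h1 : chk c N E ≡ 1
    h1 = trans (sym (ifz-pos c 1 _ (code-pos' ρ lp))) m
    A1 : ℕ
    A1 = eqn (χ I E) 1
    A2 : ℕ
    A2 = eqn (lenC E) (t N)
    A3 : ℕ
    A3 = eqn c (Φcode N E)
    a1 : A1 ≡ 1
    a1 = m*n≡1⇒m≡1 A1 A2 (m*n≡1⇒m≡1 (A1 * A2) A3 h1)
    a2 : A2 ≡ 1
    a2 = m*n≡1⇒n≡1 A1 A2 (m*n≡1⇒m≡1 (A1 * A2) A3 h1)
    a3 : A3 ≡ 1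
    a3 = m*n≡1⇒n≡1 (A1 * A2) A3 h1
    memσ : Mem I σ
    memσ = trans (cong (χ I) eσ) (eqn-sound _ 1 a1)
    lenσ : length σ ≡ t (length ρ ∸ 1)
    lenσ = trans (sym (lenC-code σ)) (trans (cong lenC eσ) (trans (eqn-sound _ _ a2) (cong t eN)))
    ρeq : ρ ≡ Φ (length ρ ∸ 1) σ
    ρeq = code-inj _ _ (trans (eqn-sound _ _ a3) (trans (cong₂ Φcode eN (sym eσ)) (Φcode-correct (length ρ ∸ 1) σ)))

  -- I′ is prefix closed: a prefix of Φ (L + 1) σ is Φ L (σ ↾ t L), since t is nondecreasing.
  pcl : ∀ s a → χ' (code (s ++ a ∷ [])) ≡ 1 → χ' (code s) ≡ 1
  pcl [] a m = refl
  pcl (s0 ∷ s') a m with elim (s0 ∷ s' ++ a ∷ []) (s≤s z≤n) m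
  ... | σ , memσ , lenσ , eq = subst (λ z → χ' (code z) ≡ 1) (sym sEq) (intro L (take (t L) σ) (Mem-take (t L) σ memσ) lenT)
    where
    L : ℕ
    L = length s'
    s : List ℕ
    s = s0 ∷ s'
    eN : length (s ++ a ∷ []) ∸ 1 ≡ suc L
    eN = cong (_∸ 1) (trans (LP.length-++ s) (+-comm (suc L) 1))
    F : ℕ → ℕ
    F = λ k → code (take (t k) σ)
    eq' : s ++ a ∷ [] ≡ applyUpTo F (suc L) ++ F (suc L) ∷ []
    eq' = trans eq (trans (cong (λ z → Φ z σ) eN) (sym (LP.applyUpTo-∷ʳ F (suc L))))
    sEq0 : s ≡ applyUpTo F (suc L)
    sEq0 = LP.∷ʳ-injectiveˡ s (applyUpTo F (suc L)) eq'
    lenσ' : length σ ≡ t (suc L)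
    lenσ' = trans lenσ (cong t eN)
    sEq : s ≡ Φ L (take (t L) σ)
    sEq = trans sEq0 (app-cong F _ (suc L) (λ k lt → cong code (sym (trans (LP.take-take (t k) (t L) σ) (cong (λ z → take z σ) (m≤n⇒m⊓n≡m (tmono k L (≤-pred lt))))))))
    lenT : length (take (t L) σ) ≡ t L
    lenT = trans (LP.length-take (t L) σ) (trans (cong (t L ⊓_) lenσ') (m≤n⇒m⊓n≡m (tmono L (suc L) (n≤1+n L))))

  bdd : ∀ s → χ' (code s) ≡ 1 → All (λ a → a ≤ b' (length s)) s
  bdd [] m = []
  bdd (s0 ∷ s') m with elim (s0 ∷ s') (s≤s z≤n) m
  ... | σ , memσ , lenσ , eq = subst (All (λ a → a ≤ b' (length (s0 ∷ s')))) (sym eq)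
          (allApp _ (suc N) (λ k → <⇒≤ (≤-trans (s≤s (code-take-le (t k) σ)) bnd)))
    where
    N : ℕ
    N = length s'
    bnd : suc (code σ) ≤ b' (suc N)
    bnd = subst (λ L → suc (code σ) ≤ 2 ^ ((b I L + 1) * L)) lenσ (code-bound (b I (length σ)) σ (bounded I σ memσ))

  I' : PRBTree
  I' = record { χ = χ' ; χ-pr = toPR1 rχ' ; b = b' ; b-pr = toPR1 rb' ; prefix-closed = pcl ; bounded = bdd }

  Φ-pr : IsPRStr2 Φ
  Φ-pr = Φcode , toPR2 (ext rHΦ λ { x (a ∷ e ∷ []) → refl }) , Φcode-correct

  Φ-node : ∀ n σ → Mem I σ → length σ ≡ t n → Mem I' (Φ n σ) × length (Φ n σ) ≡ suc n
  Φ-node n σ m e = intro n σ m e , lenΦ n σ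
  Φ-injective : ∀ n σ τ → Mem I σ → length σ ≡ t n → Mem I τ → length τ ≡ t n → Φ n σ ≡ Φ n τ → σ ≡ τ
  Φ-injective n σ τ _ eσ _ eτ eq = code-inj σ τ (trans (sym (lastΦ n σ eσ)) (trans (cong (λ l → nthL l n) eq) (lastΦ n τ eτ)))
  Φ-onto : ∀ n ρ → Mem I' ρ → length ρ ≡ suc n → ∃[ σ ] (Mem I σ × length σ ≡ t n × Φ n σ ≡ ρ)
  Φ-onto n ρ m e with elim ρ (≤-trans (s≤s z≤n) (≤-reflexive (sym e))) m
  ... | σ , memσ , lenσ , eq = σ , memσ , trans lenσ (cong (λ L → t (L ∸ 1)) e) , sym (trans eq (cong (λ L → Φ (L ∸ 1) σ) e))
  -- … and it preserves and reflects extension, since the entries of Φ n τ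
  -- are the codes of the prefixes τ ↾ t k, k ≤ n.
  Φ-⊑ : ∀ m n σ τ → m ≤ n → Mem I σ → length σ ≡ t m → Mem I τ → length τ ≡ t n → (σ ⊑ τ ⇔ Φ m σ ⊑ Φ n τ)
  Φ-⊑ m n σ τ le _ eσ _ eτ = mk⇔ to from
    where
    Fτ : ℕ → ℕ
    Fτ k = code (take (t k) τ)
    to : σ ⊑ τ → Φ m σ ⊑ Φ n τ
    to (w , e) = applyUpTo (λ i → Fτ (suc m + i)) (n ∸ m) ,
      sym (trans (cong (applyUpTo Fτ) (cong suc (sym (m+[n∸m]≡n le))))
           (trans (app-split Fτ (suc m) (n ∸ m)) (cong (_++ applyUpTo (λ i → Fτ (suc m + i)) (n ∸ m)) (app-cong Fτ _ (suc m) pw))))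
      where
      pw : ∀ k → k < suc m → Fτ k ≡ code (take (t k) σ)
      pw k lt = cong code (trans (cong (take (t k)) (sym e)) (take-++ (t k) σ w (≤-trans (tmono k m (≤-pred lt)) (≤-reflexive (sym eσ)))))
    from : Φ m σ ⊑ Φ n τ → σ ⊑ τ
    from (w , e) = drop (t m) τ , trans (cong (_++ drop (t m) τ) σeq) (LP.take++drop≡id (t m) τ)
      where
      c1 : code σ ≡ code (take (t m) τ)
      c1 = trans (sym (lastΦ m σ eσ)) (trans (sym (nthL-++ (Φ m σ) w m (≤-reflexive (sym (lenΦ m σ)))))
             (trans (cong (λ l → nthL l m) e) (nthL-app Fτ (suc n) m (s≤s le))))
      σeq : σ ≡ take (t m) τ
      σeq = code-inj _ _ c1

module NoLookaheadProof where

  open import Defs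
  open PrimRep
  open StringCode
  open StringIndex
  open StringOps
  open RegisterRuns
  open import Data.Nat
  open import Data.Nat.Properties
  open import Data.Bool using (false)
  open import Data.Vec using ([]; _∷_; head)
  open import Data.List using (List; []; _∷_)
  import Data.List.Properties as LP
  open import Data.Product using (_,_; _×_; ∃-syntax)
  open import Relation.Binary.PropositionalEquality
  open import Function.Bundles using (_⇔_; mk⇔)

  module ReadOff (I : PRBTree) (f : (ℕ → ℕ) → ℕ → ℕ) (M : Program) (t : ℕ → ℕ) (tpr : IsPR1 t)
                 (tmono : Nondecreasing t) (tf : TimeFn I f M t) where
    open LookaheadTree I t tpr tmono
    open Simulation (λ x aux pos → nthC pos aux) {false} rNth (Rm M)
    -- The value f x n is read off from the last entry code (x ↾ t n) of the I′-node:
    -- run M for t n steps against the oracle pos ↦ (pos-th entry of that code).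
    repG : Rep false {1} (λ x v → entry (simCode (λ pos → nthC pos (nthC (lenC (head v) ∸ 1) (head v))) M (t (lenC (head v) ∸ 1)) (lenC (head v) ∸ 1)) 1)
    repG = rOut M {N = λ _ v → lenC (head v) ∸ 1} {AX = λ _ v → nthC (lenC (head v) ∸ 1) (head v)} {t = t}
                (ext (rLenC · rP #0 ⊖ rK 1) λ { x (c ∷ []) → refl })
                (ext (rC rNth (rLenC · rP #0 ⊖ rK 1 ∷ʳ rP #0 ∷ʳ []ʳ)) λ { x (c ∷ []) → refl }) (rPR1 tpr)
    g : ℕ → ℕ
    g c = entry (simCode (λ pos → nthC pos (nthC (lenC c ∸ 1) c)) M (t (lenC c ∸ 1)) (lenC c ∸ 1)) 1
    readOff : ∃[ g ] (IsPR1 g × (∀ x → Path I x → ∀ n → f x n ≡ g (code (Φ n (x ↾ t n)))))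
    readOff = g , toPR1 repG , main
      where
      -- Within t n steps M only queries positions below t n, where the oracle
      -- agrees with x; so the simulated run is the real one.
      main : ∀ x → Path I x → ∀ n → f x n ≡ g (code (Φ n (x ↾ t n)))
      main x px n with tf x px n
      ... | s , s≤ , hl , oe , _ , qb = sym (trans eqG (trans (entry-reg (run y M (t n) (init n)) 0 (Rm-pos M))
                                           (trans (cong (λ c → reg c 0) rt) oe)))
        where
        σ : List ℕ
        σ = x ↾ t n
        c : ℕ
        c = code (Φ n σ)
        eN : lenC c ∸ 1 ≡ n
        eN = cong (_∸ 1) (trans (lenC-code (Φ n σ)) (lenΦ n σ))
        eA : nthC (lenC c ∸ 1) c ≡ code σ
        eA = trans (cong (λ z → nthC z c) eN) (trans (nthC-code n (Φ n σ)) (lastΦ n σ (len↾ x (t n))))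
        y : ℕ → ℕ
        y pos = nthC pos (code σ)
        eqG : g c ≡ entry (encConfig (run y M (t n) (init n))) 1
        eqG = trans (cong₂ (λ A N → entry (simCode (λ pos → nthC pos A) M (t N) N) 1) eA eN) (cong (λ z → entry z 1) (simCode-correct y M (t n) n (allOK M)))
        ag : ∀ p → p < t n → y p ≡ x p
        ag p lt = trans (nthC-code p σ) (trans (cong (λ l → nthL l p) (LP.map-upTo x (t n))) (nthL-app x (t n) p lt))
        ra : run y M s (init n) ≡ run x M s (init n)
        ra = run-agree x y M (init n) s (t n) qb ag s ≤-refl
        rt : run y M (t n) (init n) ≡ run x M s (init n)
        rt = trans (run-tn y M s (t n) (init n) s≤ (subst (Halted M) (sym ra) hl)) ra

  timeFn⇒noLookahead : ∀ I f M t → IsPR1 t → Nondecreasing t → TimeFn I f M t → NoLookahead I f t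
  timeFn⇒noLookahead I f M t tpr tmono tf =
    I' , Φ , Φ-pr , Φ-node , Φ-injective , Φ-onto , Φ-⊑ , ReadOff.readOff I f M t tpr tmono tf
    where open LookaheadTree I t tpr tmono

open FromTimeFn using (timeFn⇒prFunctional)
open ToTimeFn using (prFunctional⇒timeFn)
open NoLookaheadProof using (timeFn⇒noLookahead)

-- Lemma 3.5.  The three parts are the three results above.
lemma3p5 : (I : PRBTree) (f : (ℕ → ℕ) → ℕ → ℕ) → IsTuringFunctional I f →
    (HasPRTimeFn I f ⇔ IsPRFunctional I f)
    × (∀ M t → IsPR1 t → Nondecreasing t → TimeFn I f M t → NoLookahead I f t)
lemma3p5 I f _ = mk⇔ (timeFn⇒prFunctional I f) (prFunctional⇒timeFn I f) , timeFn⇒noLookahead I f
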